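{- For every positive integer $n$, let $\mathcal{Q}_n$ be the set of permutations $\pi\in\mathfrak{S}_n$ with no successions, and let $$P_n(x)=\sum_{\pi\in\mathcal{Q}_n}x^{{\rm asc}(\pi)+1}.$$ Then $P_n(x)$ is bi-$\gamma$-positive in the following sense: there are polynomials $a(x),b(x)$ with $P_n(x)=a(x)+x\,b(x)$, $x^na(1/x)=a(x)$, $x^{n-1}b(1/x)=b(x)$, and nonnegative numbers $\alpha_k,\beta_k$ with $$a(x)=\sum_{k=0}^{\lfloor n/2\rfloor}\alpha_kx^k(1+x)^{n-2k},\qquad b(x)=\sum_{k=0}^{\lfloor (n-1)/2\rfloor}\beta_kx^k(1+x)^{n-1-2k}.$$
   Context: $\mathfrak{S}_n$ is the symmetric group on $[n]=\{1,\dots,n\}$, permutations written $\pi=\pi(1)\cdots\pi(n)$. A succession of $\pi$ is an index $k\in[n-1]$ with $\pi(k+1)=\pi(k)+1$. ${\rm asc}(\pi)=\#\{i\in[n-1]:\pi(i)<\pi(i+1)\}$. -}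

module Defs where

open import Data.Nat using (ℕ; zero; suc; _+_; _<_; _≤_; _<?_; _∸_; _/_)
import Data.Nat as ℕ
open import Data.Integer as ℤ using (ℤ; +_)
open import Data.Fin as Fin using (Fin; toℕ)
open import Data.Product using (_×_; _,_)
import Data.List
open import Data.List using (List; []; _∷_; map; concatMap; filter; foldr; upTo; length)
open import Relation.Nullary using (Dec; yes; no; ¬_)
open import Relation.Unary using (Decidable)
open import Relation.Binary.PropositionalEquality using (_≡_)
import Data.List.Relation.Unary.Unique.DecPropositional as UDec
open import Data.List.Relation.Unary.All as All using (All; all?)

-- A permutation π ∈ 𝔖_n is represented by its one-line notation
-- π(1) ⋯ π(n) as a list of length n with entries in Fin n
-- (entry v ∈ Fin n stands for toℕ v + 1 ∈ [n]) and no repeated entries.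

words : (n k : ℕ) → List (List (Fin n))
words n zero    = [] ∷ []
words n (suc k) = concatMap (λ x → map (x ∷_) (words n k)) (Data.List.allFin n)

perms : (n : ℕ) → List (List (Fin n))
perms n = filter (UDec.unique? Fin._≟_) (words n n)

adjPairs : {A : Set} → List A → List (A × A)
adjPairs []           = []
adjPairs (x ∷ [])     = []
adjPairs (x ∷ y ∷ xs) = (x , y) ∷ adjPairs (y ∷ xs)

asc : {n : ℕ} → List (Fin n) → ℕ
asc π = length (filter (λ p → toℕ (Data.Product.proj₁ p) <? toℕ (Data.Product.proj₂ p)) (adjPairs π))
  where import Data.Product

IsSuccession : {n : ℕ} → Fin n × Fin n → Set
IsSuccession (u , v) = toℕ v ≡ suc (toℕ u)

isSuccession? : {n : ℕ} → Decidable (IsSuccession {n})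
isSuccession? (u , v) = toℕ v ℕ.≟ suc (toℕ u)

NoSuccession : {n : ℕ} → List (Fin n) → Set
NoSuccession π = All (λ p → ¬ IsSuccession p) (adjPairs π)

noSuccession? : {n : ℕ} → Decidable (NoSuccession {n})
noSuccession? π = all? (λ p → Relation.Nullary.¬? (isSuccession? p)) (adjPairs π)
  where import Relation.Nullary

Q : (n : ℕ) → List (List (Fin n))
Q n = filter noSuccession? (perms n)

-- Polynomials with integer coefficients, as coefficient lists
-- (constant term first).  Two polynomials are equal iff all their
-- coefficients agree (trailing zeros are irrelevant).

Poly : Set
Poly = List ℤ

coeff : Poly → ℕ → ℤ
coeff []       _       = + 0
coeff (c ∷ _)  zero    = c
coeff (_ ∷ cs) (suc i) = coeff cs i

_≈ₚ_ : Poly → Poly → Set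
p ≈ₚ q = ∀ i → coeff p i ≡ coeff q i

infixl 6 _⊕_
infixl 7 _⊛_ _·ₚ_

_⊕_ : Poly → Poly → Poly
[]       ⊕ q        = q
(c ∷ p)  ⊕ []       = c ∷ p
(c ∷ p)  ⊕ (d ∷ q)  = (c ℤ.+ d) ∷ (p ⊕ q)

_·ₚ_ : ℤ → Poly → Poly
c ·ₚ p = map (c ℤ.*_) p

_⊛_ : Poly → Poly → Poly
[]      ⊛ q = []
(c ∷ p) ⊛ q = (c ·ₚ q) ⊕ (+ 0 ∷ (p ⊛ q))

one : Poly
one = + 1 ∷ []

X : Poly
X = + 0 ∷ + 1 ∷ []

_^ₚ_ : Poly → ℕ → Poly
p ^ₚ zero  = one
p ^ₚ suc m = p ⊛ (p ^ₚ m)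

Σₚ[k≤_]_ : ℕ → (ℕ → Poly) → Poly
Σₚ[k≤ m ] f = foldr (λ k acc → f k ⊕ acc) [] (upTo (suc m))

P : ℕ → Poly
P n = foldr (λ π acc → (X ^ₚ (asc π + 1)) ⊕ acc) [] (Q n)

-- x^d p(1/x) = p(x), i.e. p has degree ≤ d and its coefficient
-- sequence is symmetric about d/2 (this is what the identity of
-- Laurent polynomials literally says, coefficientwise).
SymmetricOf : ℕ → Poly → Set
SymmetricOf d p = (∀ i → d < i → coeff p i ≡ + 0)
                × (∀ i → i ≤ d → coeff p i ≡ coeff p (d ∸ i))

gammaExpansion : ℕ → (ℕ → ℕ) → Poly
gammaExpansion d c =
  Σₚ[k≤ d / 2 ] (λ k → (+ c k) ·ₚ ((X ^ₚ k) ⊛ ((one ⊕ X) ^ₚ (d ∸ 2 ℕ.* k))))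

-- Let d_n be the derangement polynomial (derangements of [n] counted by excedances). Then P_n = d_n + x d_(n-1), and
-- d_n = Σ_k γ_(n,k) x^k (1+x)^(n-2k) with γ_(n,k) ∈ ℕ, so a = d_n and b = d_(n-1) work; each basis polynomial
-- x^k (1+x)^(d-2k) is symmetric of degree d.
--
-- Here d_n enters through succession-free permutations: among those of [0, m] with a ascents, the ones not ending
-- with m are counted by [x^(a+1)] d_(m+1) and the ones ending with m (remove it) by [x^a] d_m, which is
-- P_(m+1) = d_(m+1) + x d_m. Inserting the maximum into permutations of [0, m] while tracking ascents, successions
-- and whether the last entry is m gives recurrences for these counts; merging the s successions of a permutation
-- of [0, m] gives a factor C(m, s). Together they yield the derangement recurrence
--   d_(n+2,i+1) = (i+1) d_(n+1,i+1) + (n+1-i) d_(n+1,i) + (n+1) d_(n,i),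
-- which the γ-expansion also satisfies with the recurrence defining γ, because f ↦ N f + (1 - x) f' sends
-- x^k (1+x)^(N-2k) to k x^(k-1) (1+x)^(N+1-2k) + 2 (N-2k) x^k (1+x)^(N-1-2k).

module Submission where

open import Defs
open import Data.Bool using (Bool; true; false; T; if_then_else_; _∧_; not)
open import Data.Bool.Properties using (T-≡; ∧-comm; ∧-zeroʳ) renaming (_≟_ to _≟ᵇ_)
open import Data.Empty using (⊥; ⊥-elim)
open import Data.Fin as Fin using (Fin; toℕ; fromℕ<)
import Data.Fin.Properties as Fin
import Data.Integer as ℤ
open ℤ using (+_)
import Data.Integer.Properties as ℤ
open import Data.List using (List; []; _∷_; map; concatMap; _++_; length; filter; foldr; applyUpTo; drop; allFin)
import Data.List.Properties as List
open import Data.List.Membership.Propositional using (_∈_; _∉_; find; lose)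
open import Data.List.Membership.Propositional.Properties
  using (∈-map⁻; ∈-map⁺; ∈-concatMap⁻; ∈-concatMap⁺; ∈-++⁺ˡ; ∈-∃++; ∈-allFin; ∈-filter⁻; ∈-filter⁺)
open import Data.List.Membership.Propositional.Properties.WithK using (unique∧set⇒bag)
open import Data.List.Relation.Binary.BagAndSetEquality using (∼bag⇒↭)
open import Data.List.Relation.Binary.Permutation.Propositional using (_↭_)
import Data.List.Relation.Binary.Permutation.Propositional.Properties as ↭
open import Data.List.Relation.Unary.All as All using (All; []; _∷_)
import Data.List.Relation.Unary.All.Properties as All
open import Data.List.Relation.Unary.AllPairs using ([]; _∷_)
open import Data.List.Relation.Unary.Any using (here; there)
open import Data.List.Relation.Unary.Unique.Propositional using (Unique)
import Data.List.Relation.Unary.Unique.Propositional.Properties as Unique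
import Data.List.Relation.Unary.Unique.DecPropositional as UniqueDec
open import Data.Nat
open import Data.Nat.Combinatorics
  using (_C_; nC1≡n; k>n⇒nCk≡0; nCk≡nC[n∸k]; nCk+nC[k+1]≡[n+1]C[k+1])
open import Data.Nat.DivMod using (_/_; _%_; m/n≤m; m/n*n≤m; m≡m%n+[m/n]*n; m%n<n)
open import Data.Nat.Induction using (<-rec)
open import Data.Nat.ListAction using (sum)
open import Data.Nat.ListAction.Properties using (sum-↭)
open import Data.Nat.Properties
open import Algebra.Properties.CommutativeSemigroup +-commutativeSemigroup
  using () renaming (interchange to +-interchange)
open import Data.List.Membership.DecPropositional _≟_ using (_∈?_)
open import Data.Nat.Tactic.RingSolver using (solve-∀)
open import Data.Product using (Σ; ∃; ∃₂; _×_; _,_; proj₁; proj₂)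
open import Data.Sum using (inj₁; inj₂)
open import Function.Bundles using (Equivalence; mk⇔)
open import Relation.Binary.PropositionalEquality
open import Relation.Nullary using (Dec; does; ¬_; yes; no)
open import Relation.Nullary.Decidable using (dec-true; dec-false)
open import Relation.Unary using (Decidable)

private
  variable
    A B : Set

-- Binomial coefficients and the basis x^k (1+x)^(d-2k)

[n+1]C[k+1]≡nCk+nC[k+1] : ∀ n k → suc n C suc k ≡ n C k + n C suc k
[n+1]C[k+1]≡nCk+nC[k+1] n k = sym (nCk+nC[k+1]≡[n+1]C[k+1] n k)

[k+1]*[n+1]C[k+1]≡[n+1]*nCk : ∀ n k → suc k * (suc n C suc k) ≡ suc n * (n C k)
[k+1]*[n+1]C[k+1]≡[n+1]*nCk n zero =
  trans (*-identityˡ _) (trans (nC1≡n (suc n)) (sym (*-identityʳ (suc n))))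
[k+1]*[n+1]C[k+1]≡[n+1]*nCk zero (suc k) = *-zeroʳ (2 + k)
[k+1]*[n+1]C[k+1]≡[n+1]*nCk (suc n) (suc k) = begin
    (2 + k) * ((2 + n) C (2 + k))
  ≡⟨ cong ((2 + k) *_) ([n+1]C[k+1]≡nCk+nC[k+1] (suc n) (suc k)) ⟩
    (2 + k) * ((1 + n) C (1 + k) + (1 + n) C (2 + k))
  ≡⟨ *-distribˡ-+ (2 + k) ((1 + n) C (1 + k)) _ ⟩
    (1 + n) C (1 + k) + (1 + k) * ((1 + n) C (1 + k)) + (2 + k) * ((1 + n) C (2 + k))
  ≡⟨ cong₂ (λ u v → (1 + n) C (1 + k) + u + v)
           ([k+1]*[n+1]C[k+1]≡[n+1]*nCk n k) ([k+1]*[n+1]C[k+1]≡[n+1]*nCk n (suc k)) ⟩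
    (1 + n) C (1 + k) + (1 + n) * (n C k) + (1 + n) * (n C (1 + k))
  ≡⟨ +-assoc ((1 + n) C (1 + k)) _ _ ⟩
    (1 + n) C (1 + k) + ((1 + n) * (n C k) + (1 + n) * (n C (1 + k)))
  ≡⟨ cong (_+_ ((1 + n) C (1 + k))) (sym (*-distribˡ-+ (1 + n) (n C k) _)) ⟩
    (1 + n) C (1 + k) + (1 + n) * (n C k + n C (1 + k))
  ≡⟨ cong (λ u → (1 + n) C (1 + k) + (1 + n) * u) (nCk+nC[k+1]≡[n+1]C[k+1] n k) ⟩
    (2 + n) * ((1 + n) C (1 + k))
  ∎
  where open ≡-Reasoning

[n∸k]*nCk≡[k+1]*nC[k+1] : ∀ n k → (n ∸ k) * (n C k) ≡ suc k * (n C suc k)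
[n∸k]*nCk≡[k+1]*nC[k+1] zero    zero    = refl
[n∸k]*nCk≡[k+1]*nC[k+1] zero    (suc k) = sym (*-zeroʳ (2 + k))
[n∸k]*nCk≡[k+1]*nC[k+1] (suc n) zero    =
  trans (*-identityʳ (suc n)) (sym (trans (*-identityˡ _) (nC1≡n (suc n))))
[n∸k]*nCk≡[k+1]*nC[k+1] (suc n) (suc k) =
  begin
    (n ∸ k) * (suc n C suc k)
  ≡⟨ cong ((n ∸ k) *_) ([n+1]C[k+1]≡nCk+nC[k+1] n k) ⟩
    (n ∸ k) * (n C k + n C suc k)
  ≡⟨ absorb (k ≤? n) ⟩
    suc n * (n C suc k)
  ≡⟨ [k+1]*[n+1]C[k+1]≡[n+1]*nCk n (suc k) ⟨
    (2 + k) * (suc n C (2 + k))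
  ∎
  where
  open ≡-Reasoning
  absorb : Dec (k ≤ n) → (n ∸ k) * (n C k + n C suc k) ≡ suc n * (n C suc k)
  absorb (no k≰n) rewrite k>n⇒nCk≡0 (≰⇒> k≰n) | k>n⇒nCk≡0 (m<n⇒m<1+n (≰⇒> k≰n)) =
    trans (*-zeroʳ (n ∸ k)) (sym (*-zeroʳ (suc n)))
  absorb (yes k≤n) = begin
      (n ∸ k) * (n C k + n C suc k)
    ≡⟨ *-distribˡ-+ (n ∸ k) (n C k) _ ⟩
      (n ∸ k) * (n C k) + (n ∸ k) * (n C suc k)
    ≡⟨ cong (_+ (n ∸ k) * (n C suc k)) ([n∸k]*nCk≡[k+1]*nC[k+1] n k) ⟩
      suc k * (n C suc k) + (n ∸ k) * (n C suc k)
    ≡⟨ *-distribʳ-+ (n C suc k) (suc k) (n ∸ k) ⟨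
      (suc k + (n ∸ k)) * (n C suc k)
    ≡⟨ cong (λ u → suc u * (n C suc k)) (m+[n∸m]≡n k≤n) ⟩
      suc n * (n C suc k)
    ∎

-- basisCoeff d k i is the coefficient of x^i in x^k (1+x)^(d-2k).
basisCoeff : ℕ → ℕ → ℕ → ℕ
basisCoeff d zero    i       = d C i
basisCoeff d (suc k) zero    = 0
basisCoeff d (suc k) (suc i) = basisCoeff (d ∸ 2) k i

2[1+k]≰1 : ∀ k → 2 * suc k ≰ 1
2[1+k]≰1 k le rewrite *-suc 2 k with le
... | s≤s ()

2[1+k]≤2+d⇒2k≤d : ∀ k d → 2 * suc k ≤ 2 + d → 2 * k ≤ d
2[1+k]≤2+d⇒2k≤d k d le rewrite *-suc 2 k = s≤s⁻¹ (s≤s⁻¹ le)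

basisCoeff-pascal : ∀ d k i → 2 * k ≤ d →
  basisCoeff (suc d) k (suc i) ≡ basisCoeff d k (suc i) + basisCoeff d k i
basisCoeff-pascal d             zero    i       _  =
  trans ([n+1]C[k+1]≡nCk+nC[k+1] d i) (+-comm (d C i) _)
basisCoeff-pascal zero          (suc k) i       le = ⊥-elim (2[1+k]≰1 k (≤-trans le z≤n))
basisCoeff-pascal 1             (suc k) i       le = ⊥-elim (2[1+k]≰1 k le)
basisCoeff-pascal (suc (suc d)) 1       zero    le = refl
basisCoeff-pascal (suc (suc d)) (suc (suc k))  zero    le = refl
basisCoeff-pascal (suc (suc d)) (suc k) (suc i) le =
  basisCoeff-pascal d k i (2[1+k]≤2+d⇒2k≤d k d le)

basisCoeff-vanish : ∀ d k i → 2 * k ≤ d → d < i → basisCoeff d k i ≡ 0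
basisCoeff-vanish d             zero    i       _  d<i       = k>n⇒nCk≡0 d<i
basisCoeff-vanish zero          (suc k) i       le _         = ⊥-elim (2[1+k]≰1 k (≤-trans le z≤n))
basisCoeff-vanish 1             (suc k) i       le _         = ⊥-elim (2[1+k]≰1 k le)
basisCoeff-vanish (suc (suc d)) (suc k) zero    _  _         = refl
basisCoeff-vanish (suc (suc d)) (suc k) (suc i) le (s≤s 1+d<i) =
  basisCoeff-vanish d k i (2[1+k]≤2+d⇒2k≤d k d le) (≤-trans (n≤1+n _) 1+d<i)

basisCoeff-sym : ∀ d k i → 2 * k ≤ d → i ≤ d → basisCoeff d k i ≡ basisCoeff d k (d ∸ i)
basisCoeff-sym d             zero    i       _  i≤d = nCk≡nC[n∸k] i≤d
basisCoeff-sym zero          (suc k) i       le _   = ⊥-elim (2[1+k]≰1 k (≤-trans le z≤n))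
basisCoeff-sym 1             (suc k) i       le _   = ⊥-elim (2[1+k]≰1 k le)
basisCoeff-sym (suc (suc d)) (suc k) zero    le _   =
  sym (basisCoeff-vanish d k (suc d) (2[1+k]≤2+d⇒2k≤d k d le) (n<1+n d))
basisCoeff-sym (suc (suc d)) (suc k) (suc i) le (s≤s i≤1+d) with m≤n⇒m<n∨m≡n i≤1+d
... | inj₂ refl rewrite n∸n≡0 i = basisCoeff-vanish d k i (2[1+k]≤2+d⇒2k≤d k d le) (n<1+n d)
... | inj₁ (s≤s i≤d) rewrite +-∸-assoc 1 i≤d = basisCoeff-sym d k i (2[1+k]≤2+d⇒2k≤d k d le) i≤d

-- Coefficientwise, this is  N f + (1 - x) f' = k x^(k-1) (1+x)^(N+1-2k) + 2 (N-2k) x^k (1+x)^(N-1-2k)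
-- for f = x^k (1+x)^(N-2k) and N = 1 + n.
basisCoeff-recurrence : ∀ n k i → 2 * k ≤ suc n →
  suc i * basisCoeff (suc n) k (suc i) + (suc n ∸ i) * basisCoeff (suc n) k i
  ≡ k * basisCoeff (2 + n) k (suc i) + 2 * (suc n ∸ 2 * k) * basisCoeff n k i
basisCoeff-recurrence n zero i _ = begin
    suc i * (suc n C suc i) + (suc n ∸ i) * (suc n C i)
  ≡⟨ cong (_+_ (suc i * (suc n C suc i))) ([n∸k]*nCk≡[k+1]*nC[k+1] (suc n) i) ⟩
    suc i * (suc n C suc i) + suc i * (suc n C suc i)
  ≡⟨ cong (λ x → x + x) ([k+1]*[n+1]C[k+1]≡[n+1]*nCk n i) ⟩
    suc n * (n C i) + suc n * (n C i)
  ≡⟨ double (suc n) (n C i) ⟩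
    2 * suc n * (n C i)
  ∎
  where
  open ≡-Reasoning
  double : ∀ a b → a * b + a * b ≡ 2 * a * b
  double = solve-∀
basisCoeff-recurrence n 1 zero _ =
  cong suc (trans (*-zeroʳ (suc n)) (sym (*-zeroʳ (2 * (n ∸ 1)))))
basisCoeff-recurrence n (suc (suc k)) zero _ =
  trans (*-zeroʳ (suc n)) (sym (cong₂ _+_ (*-zeroʳ (2 + k)) (*-zeroʳ (2 * (suc n ∸ 2 * (2 + k))))))
basisCoeff-recurrence zero (suc k) (suc i) le = ⊥-elim (2[1+k]≰1 k le)
basisCoeff-recurrence 1 1 1 _ = refl
basisCoeff-recurrence 1 1 (suc (suc i)) _ rewrite *-zeroʳ (3 + i) | 0∸n≡0 i = refl
basisCoeff-recurrence 1 (suc (suc k)) (suc i) le =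
  ⊥-elim (2[1+k]≰1 k (≤-trans (2[1+k]≤2+d⇒2k≤d (suc k) 0 le) z≤n))
basisCoeff-recurrence (suc (suc n)) (suc k) (suc i) le = begin
    (2 + i) * a + (2 + n ∸ i) * b
  ≡⟨ cong (_+_ ((2 + i) * a)) [2+n∸i]*b ⟩
    (2 + i) * a + ((1 + n ∸ i) * b + b)
  ≡⟨ split (suc i) a (1 + n ∸ i) b ⟩
    ((1 + i) * a + (1 + n ∸ i) * b) + (a + b)
  ≡⟨ cong (_+ (a + b)) (basisCoeff-recurrence n k i 2k≤1+n) ⟩
    k * basisCoeff (2 + n) k (suc i) + c + (a + b)
  ≡⟨ cong (λ x → k * x + c + (a + b)) (basisCoeff-pascal (suc n) k i 2k≤1+n) ⟩
    k * (a + b) + c + (a + b)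
  ≡⟨ merge k (a + b) c ⟩
    suc k * (a + b) + c
  ≡⟨ cong (λ x → suc k * x + c) (basisCoeff-pascal (suc n) k i 2k≤1+n) ⟨
    suc k * basisCoeff (2 + n) k (suc i) + c
  ≡⟨ cong (λ x → suc k * basisCoeff (2 + n) k (suc i) + 2 * x * basisCoeff n k i) (sym 3+n∸2[1+k]) ⟩
    suc k * basisCoeff (2 + n) k (suc i) + 2 * (3 + n ∸ 2 * suc k) * basisCoeff n k i
  ∎
  where
  open ≡-Reasoning
  a b c : ℕ
  a = basisCoeff (suc n) k (suc i)
  b = basisCoeff (suc n) k i
  c = 2 * (suc n ∸ 2 * k) * basisCoeff n k i
  split : ∀ i a c b → suc i * a + (c * b + b) ≡ (i * a + c * b) + (a + b)
  split = solve-∀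
  merge : ∀ k s c → k * s + c + s ≡ suc k * s + c
  merge = solve-∀
  2k≤1+n : 2 * k ≤ suc n
  2k≤1+n = 2[1+k]≤2+d⇒2k≤d k (suc n) le
  3+n∸2[1+k] : 3 + n ∸ 2 * suc k ≡ suc n ∸ 2 * k
  3+n∸2[1+k] = cong (2 + n ∸_) (+-suc k (k + 0))
  [2+n∸i]*b : (2 + n ∸ i) * b ≡ (1 + n ∸ i) * b + b
  [2+n∸i]*b with i ≤? suc n
  ... | yes i≤1+n rewrite +-∸-assoc 1 i≤1+n = +-comm b _
  ... | no  i≰1+n rewrite basisCoeff-vanish (suc n) k i 2k≤1+n (≰⇒> i≰1+n) =
    trans (*-zeroʳ (2 + n ∸ i)) (sym (trans (+-identityʳ _) (*-zeroʳ (1 + n ∸ i))))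

-- The γ-coefficients

sumBelow : ℕ → (ℕ → ℕ) → ℕ
sumBelow zero    f = 0
sumBelow (suc K) f = f 0 + sumBelow K (λ k → f (suc k))

sumBelow-cong : ∀ K {f g : ℕ → ℕ} → (∀ k → k < K → f k ≡ g k) → sumBelow K f ≡ sumBelow K g
sumBelow-cong zero    eq = refl
sumBelow-cong (suc K) eq = cong₂ _+_ (eq 0 z<s) (sumBelow-cong K (λ k k<K → eq (suc k) (s<s k<K)))

sumBelow-zero : ∀ K (f : ℕ → ℕ) → (∀ k → k < K → f k ≡ 0) → sumBelow K f ≡ 0
sumBelow-zero K f eq = trans (sumBelow-cong K eq) (constant-zero K)
  where
  constant-zero : ∀ K → sumBelow K (λ _ → 0) ≡ 0
  constant-zero zero    = refl
  constant-zero (suc K) = constant-zero K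

sumBelow-distrib-+ : ∀ K (f g : ℕ → ℕ) → sumBelow K (λ k → f k + g k) ≡ sumBelow K f + sumBelow K g
sumBelow-distrib-+ zero    f g = refl
sumBelow-distrib-+ (suc K) f g
  rewrite sumBelow-distrib-+ K (λ k → f (suc k)) (λ k → g (suc k)) =
  +-interchange (f 0) (g 0) (sumBelow K (λ k → f (suc k))) (sumBelow K (λ k → g (suc k)))

sumBelow-distribˡ-* : ∀ K c (f : ℕ → ℕ) → sumBelow K (λ k → c * f k) ≡ c * sumBelow K f
sumBelow-distribˡ-* zero    c f = sym (*-zeroʳ c)
sumBelow-distribˡ-* (suc K) c f
  rewrite sumBelow-distribˡ-* K c (λ k → f (suc k)) = sym (*-distribˡ-+ c (f 0) _)

sumBelow-extend : ∀ {K L} (f : ℕ → ℕ) → K ≤ L → (∀ k → K ≤ k → f k ≡ 0) → sumBelow L f ≡ sumBelow K f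
sumBelow-extend {L = L} f z≤n       eq = sumBelow-zero L f (λ k _ → eq k z≤n)
sumBelow-extend         f (s≤s K≤L) eq =
  cong (_+_ (f 0)) (sumBelow-extend (λ k → f (suc k)) K≤L (λ k K≤k → eq (suc k) (s≤s K≤k)))

γ : ℕ → ℕ → ℕ
γ 0             0       = 1
γ 0             (suc k) = 0
γ 1             k       = 0
γ (suc (suc n)) 0       = 0
γ (suc (suc n)) (suc k) =
  suc k * γ (suc n) (suc k) + 2 * (suc n ∸ 2 * k) * γ (suc n) k + suc n * γ n k

γ-vanish : ∀ N k → N < 2 * k → γ N k ≡ 0
γ-vanish 0             (suc k) _  = refl
γ-vanish 1             k       _  = refl
γ-vanish (suc (suc n)) (suc k) lt = cong₂ _+_
  (cong₂ _+_ (*-≡0 (suc k) (γ-vanish (suc n) (suc k) (<-trans (n<1+n _) lt)))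
             (cong (λ x → 2 * x * γ (suc n) k) (m≤n⇒m∸n≡0 n<2k)))
  (*-≡0 (suc n) (γ-vanish n k n<2k))
  where
  *-≡0 : ∀ a {b} → b ≡ 0 → a * b ≡ 0
  *-≡0 a refl = *-zeroʳ a
  n<2k : n < 2 * k
  n<2k rewrite *-suc 2 k = s≤s⁻¹ (s≤s⁻¹ lt)

γ-*-cong : ∀ N k {x y} → (2 * k ≤ N → x ≡ y) → γ N k * x ≡ γ N k * y
γ-*-cong N k {x} {y} eq with 2 * k ≤? N
... | yes 2k≤N = cong (γ N k *_) (eq 2k≤N)
... | no  2k≰N rewrite γ-vanish N k (≰⇒> 2k≰N) = refl

sumBelow-γ-extend : ∀ N (f : ℕ → ℕ) {K L} → N < 2 * K → K ≤ L →
  sumBelow L (λ k → γ N k * f k) ≡ sumBelow K (λ k → γ N k * f k)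
sumBelow-γ-extend N f {K} N<2K K≤L = sumBelow-extend _ K≤L
  (λ k K≤k → cong (_* f k) (γ-vanish N k (<-≤-trans N<2K (*-monoʳ-≤ 2 K≤k))))

γcoeff : ℕ → ℕ → ℕ
γcoeff N i = sumBelow (suc N) (λ k → γ N k * basisCoeff N k i)

sumBelow-linear : ∀ K a b (f g : ℕ → ℕ) →
  sumBelow K (λ k → a * f k + b * g k) ≡ a * sumBelow K f + b * sumBelow K g
sumBelow-linear K a b f g = trans (sumBelow-distrib-+ K (λ k → a * f k) (λ k → b * g k))
  (cong₂ _+_ (sumBelow-distribˡ-* K a f) (sumBelow-distribˡ-* K b g))

module _ (n i : ℕ) where

  private
    E : ℕ → ℕ → ℕ → ℕ
    E = basisCoeff
    γ′ : ℕ → ℕ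
    γ′ = γ (suc n)
    c : ℕ → ℕ
    c k = 2 * (suc n ∸ 2 * k)
    m<2[1+m] : ∀ m → m < 2 * suc m
    m<2[1+m] m = m≤n*m (suc m) 2

  γcoeff[2+n]-unfold : γcoeff (2 + n) (suc i)
    ≡ sumBelow (2 + n) (λ k → γ′ k * (k * E (2 + n) k (suc i)) + γ′ k * (c k * E n k i)) + suc n * γcoeff n i
  γcoeff[2+n]-unfold = begin
      sumBelow (2 + n) (λ k → γ (2 + n) (suc k) * E n k i)
    ≡⟨ sumBelow-cong (2 + n) (λ k _ → expand k) ⟩
      sumBelow (2 + n) (λ k → s₁ k + s₂ k + suc n * (γ n k * E n k i))
    ≡⟨ trans (sumBelow-distrib-+ (2 + n) (λ k → s₁ k + s₂ k) (λ k → suc n * (γ n k * E n k i)))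
             (cong₂ _+_ (sumBelow-distrib-+ (2 + n) s₁ s₂)
                        (sumBelow-distribˡ-* (2 + n) (suc n) (λ k → γ n k * E n k i))) ⟩
      sumBelow (2 + n) s₁ + sumBelow (2 + n) s₂ + suc n * sumBelow (2 + n) (λ k → γ n k * E n k i)
    ≡⟨ cong₂ (λ x y → x + sumBelow (2 + n) s₂ + suc n * y) shift-s₁
             (sumBelow-γ-extend n (λ k → E n k i) (m<2[1+m] n) (n≤1+n (suc n))) ⟩
      sumBelow (2 + n) (λ k → γ′ k * (k * E (2 + n) k (suc i))) + sumBelow (2 + n) s₂ + suc n * γcoeff n i
    ≡⟨ cong (_+ suc n * γcoeff n i) (sumBelow-distrib-+ (2 + n) (λ k → γ′ k * (k * E (2 + n) k (suc i))) s₂) ⟨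
      sumBelow (2 + n) (λ k → γ′ k * (k * E (2 + n) k (suc i)) + γ′ k * (c k * E n k i)) + suc n * γcoeff n i
    ∎
    where
    open ≡-Reasoning
    s₁ s₂ : ℕ → ℕ
    s₁ k = γ′ (suc k) * (suc k * E n k i)
    s₂ k = γ′ k * (c k * E n k i)
    expand : ∀ k → γ (2 + n) (suc k) * E n k i ≡ s₁ k + s₂ k + suc n * (γ n k * E n k i)
    expand k = distribute (suc k) (γ′ (suc k)) (c k) (γ′ k) (suc n) (γ n k) (E n k i)
      where
      distribute : ∀ k g₁ c g₀ n g e → (k * g₁ + c * g₀ + n * g) * e ≡ g₁ * (k * e) + g₀ * (c * e) + n * (g * e)
      distribute = solve-∀
    -- reindexing by k ↦ 1 + k; the new k = 0 term vanishes
    shift-s₁ : sumBelow (2 + n) s₁ ≡ sumBelow (2 + n) (λ k → γ′ k * (k * E (2 + n) k (suc i)))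
    shift-s₁ = begin
        sumBelow (2 + n) s₁
      ≡⟨ cong (_+ sumBelow (2 + n) s₁) (*-zeroʳ (γ′ 0)) ⟨
        sumBelow (3 + n) (λ k → γ′ k * (k * E (2 + n) k (suc i)))
      ≡⟨ sumBelow-γ-extend (suc n) (λ k → k * E (2 + n) k (suc i)) (m<2[1+m] (suc n)) (n≤1+n (2 + n)) ⟩
        sumBelow (2 + n) (λ k → γ′ k * (k * E (2 + n) k (suc i)))
      ∎

  γcoeff[1+n]-derivation : sumBelow (2 + n) (λ k → γ′ k * (k * E (2 + n) k (suc i)) + γ′ k * (c k * E n k i))
    ≡ suc i * γcoeff (suc n) (suc i) + (suc n ∸ i) * γcoeff (suc n) i
  γcoeff[1+n]-derivation = begin
      sumBelow (2 + n) (λ k → γ′ k * (k * E (2 + n) k (suc i)) + γ′ k * (c k * E n k i))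
    ≡⟨ sumBelow-cong (2 + n) (λ k _ → derivation k) ⟩
      sumBelow (2 + n) (λ k → suc i * (γ′ k * E (suc n) k (suc i)) + (suc n ∸ i) * (γ′ k * E (suc n) k i))
    ≡⟨ sumBelow-linear (2 + n) (suc i) (suc n ∸ i)
                       (λ k → γ′ k * E (suc n) k (suc i)) (λ k → γ′ k * E (suc n) k i) ⟩
      suc i * γcoeff (suc n) (suc i) + (suc n ∸ i) * γcoeff (suc n) i
    ∎
    where
    open ≡-Reasoning
    derivation : ∀ k → γ′ k * (k * E (2 + n) k (suc i)) + γ′ k * (c k * E n k i)
                    ≡ suc i * (γ′ k * E (suc n) k (suc i)) + (suc n ∸ i) * (γ′ k * E (suc n) k i)
    derivation k = begin
        γ′ k * (k * E (2 + n) k (suc i)) + γ′ k * (c k * E n k i)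
      ≡⟨ *-distribˡ-+ (γ′ k) _ _ ⟨
        γ′ k * (k * E (2 + n) k (suc i) + c k * E n k i)
      ≡⟨ γ-*-cong (suc n) k (λ 2k≤1+n → sym (basisCoeff-recurrence n k i 2k≤1+n)) ⟩
        γ′ k * (suc i * E (suc n) k (suc i) + (suc n ∸ i) * E (suc n) k i)
      ≡⟨ distribute (γ′ k) (suc i) (E (suc n) k (suc i)) (suc n ∸ i) (E (suc n) k i) ⟩
        suc i * (γ′ k * E (suc n) k (suc i)) + (suc n ∸ i) * (γ′ k * E (suc n) k i)
      ∎
      where
      distribute : ∀ g a x b y → g * (a * x + b * y) ≡ a * (g * x) + b * (g * y)
      distribute = solve-∀

γcoeff-recurrence : ∀ n i → γcoeff (2 + n) (suc i)
  ≡ suc i * γcoeff (suc n) (suc i) + (suc n ∸ i) * γcoeff (suc n) i + suc n * γcoeff n i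
γcoeff-recurrence n i =
  trans (γcoeff[2+n]-unfold n i) (cong (_+ suc n * γcoeff n i) (γcoeff[1+n]-derivation n i))

γcoeff[2+n,0]≡0 : ∀ n → γcoeff (2 + n) 0 ≡ 0
γcoeff[2+n,0]≡0 n = sumBelow-zero (2 + n) _ (λ k _ → *-zeroʳ (γ (2 + n) (suc k)))

-- Coefficients of polynomials

coeff-⊕ : ∀ p q i → coeff (p ⊕ q) i ≡ coeff p i ℤ.+ coeff q i
coeff-⊕ []      q       i       = sym (ℤ.+-identityˡ _)
coeff-⊕ (c ∷ p) []      i       = sym (ℤ.+-identityʳ _)
coeff-⊕ (c ∷ p) (d ∷ q) zero    = refl
coeff-⊕ (c ∷ p) (d ∷ q) (suc i) = coeff-⊕ p q i

coeff-·ₚ : ∀ c p i → coeff (c ·ₚ p) i ≡ c ℤ.* coeff p i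
coeff-·ₚ c []      i       = sym (ℤ.*-zeroʳ c)
coeff-·ₚ c (x ∷ p) zero    = refl
coeff-·ₚ c (x ∷ p) (suc i) = coeff-·ₚ c p i

coeff-drop1 : ∀ p i → coeff (drop 1 p) i ≡ coeff p (suc i)
coeff-drop1 []      i = refl
coeff-drop1 (c ∷ p) i = refl

coeff-⊛-zero : ∀ p q → coeff (p ⊛ q) 0 ≡ coeff p 0 ℤ.* coeff q 0
coeff-⊛-zero []      q = refl
coeff-⊛-zero (c ∷ p) q =
  trans (coeff-⊕ (c ·ₚ q) _ 0) (trans (ℤ.+-identityʳ _) (coeff-·ₚ c q 0))

coeff-⊛-suc : ∀ p q i → coeff (p ⊛ q) (suc i) ≡ coeff p 0 ℤ.* coeff q (suc i) ℤ.+ coeff (drop 1 p ⊛ q) i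
coeff-⊛-suc []      q i = refl
coeff-⊛-suc (c ∷ p) q i =
  trans (coeff-⊕ (c ·ₚ q) _ (suc i)) (cong (ℤ._+ coeff (p ⊛ q) i) (coeff-·ₚ c q (suc i)))

⊛-congˡ : ∀ p p′ q → p ≈ₚ p′ → (p ⊛ q) ≈ₚ (p′ ⊛ q)
⊛-congˡ p p′ q eq zero =
  trans (coeff-⊛-zero p q) (trans (cong (ℤ._* coeff q 0) (eq 0)) (sym (coeff-⊛-zero p′ q)))
⊛-congˡ p p′ q eq (suc i) = begin
    coeff (p ⊛ q) (suc i)
  ≡⟨ coeff-⊛-suc p q i ⟩
    coeff p 0 ℤ.* coeff q (suc i) ℤ.+ coeff (drop 1 p ⊛ q) i
  ≡⟨ cong₂ (λ a b → a ℤ.* coeff q (suc i) ℤ.+ b) (eq 0) (⊛-congˡ (drop 1 p) (drop 1 p′) q drop1-cong i) ⟩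
    coeff p′ 0 ℤ.* coeff q (suc i) ℤ.+ coeff (drop 1 p′ ⊛ q) i
  ≡⟨ coeff-⊛-suc p′ q i ⟨
    coeff (p′ ⊛ q) (suc i)
  ∎
  where
  open ≡-Reasoning
  drop1-cong : drop 1 p ≈ₚ drop 1 p′
  drop1-cong j = trans (coeff-drop1 p j) (trans (eq (suc j)) (sym (coeff-drop1 p′ j)))

one⊛ : ∀ q → (one ⊛ q) ≈ₚ q
one⊛ q zero    = trans (coeff-⊛-zero one q) (ℤ.*-identityˡ _)
one⊛ q (suc i) = trans (coeff-⊛-suc one q i) (trans (ℤ.+-identityʳ _) (ℤ.*-identityˡ _))

X⊛ : ∀ q → (X ⊛ q) ≈ₚ (+ 0 ∷ q)
X⊛ q zero    = coeff-⊛-zero X q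
X⊛ q (suc i) = trans (coeff-⊛-suc X q i) (trans (ℤ.+-identityˡ _) (one⊛ q i))

[0∷p]⊛ : ∀ p q → ((+ 0 ∷ p) ⊛ q) ≈ₚ (+ 0 ∷ (p ⊛ q))
[0∷p]⊛ p q zero    = coeff-⊛-zero (+ 0 ∷ p) q
[0∷p]⊛ p q (suc i) = trans (coeff-⊛-suc (+ 0 ∷ p) q i) (ℤ.+-identityˡ _)

X^[1+k]⊛ : ∀ k q → ((X ^ₚ suc k) ⊛ q) ≈ₚ (+ 0 ∷ ((X ^ₚ k) ⊛ q))
X^[1+k]⊛ k q i = trans (⊛-congˡ (X ⊛ (X ^ₚ k)) (+ 0 ∷ (X ^ₚ k)) q (X⊛ (X ^ₚ k)) i) ([0∷p]⊛ (X ^ₚ k) q i)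

coeff-[1+X]^ : ∀ m i → coeff ((one ⊕ X) ^ₚ m) i ≡ + (m C i)
coeff-[1+X]^ zero    zero    = refl
coeff-[1+X]^ zero    (suc i) = refl
coeff-[1+X]^ (suc m) zero    =
  trans (coeff-⊛-zero (one ⊕ X) ((one ⊕ X) ^ₚ m)) (trans (ℤ.*-identityˡ _) (coeff-[1+X]^ m 0))
coeff-[1+X]^ (suc m) (suc i) = begin
    coeff ((one ⊕ X) ⊛ ((one ⊕ X) ^ₚ m)) (suc i)
  ≡⟨ coeff-⊛-suc (one ⊕ X) ((one ⊕ X) ^ₚ m) i ⟩
    + 1 ℤ.* coeff ((one ⊕ X) ^ₚ m) (suc i) ℤ.+ coeff (one ⊛ ((one ⊕ X) ^ₚ m)) i
  ≡⟨ cong₂ ℤ._+_ (ℤ.*-identityˡ (coeff ((one ⊕ X) ^ₚ m) (suc i))) (one⊛ ((one ⊕ X) ^ₚ m) i) ⟩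
    coeff ((one ⊕ X) ^ₚ m) (suc i) ℤ.+ coeff ((one ⊕ X) ^ₚ m) i
  ≡⟨ cong₂ ℤ._+_ (coeff-[1+X]^ m (suc i)) (coeff-[1+X]^ m i) ⟩
    + (m C suc i) ℤ.+ + (m C i)
  ≡⟨ ℤ.pos-+ (m C suc i) (m C i) ⟨
    + (m C suc i + m C i)
  ≡⟨ cong +_ (trans (+-comm (m C suc i) (m C i)) (sym ([n+1]C[k+1]≡nCk+nC[k+1] m i))) ⟩
    + (suc m C suc i)
  ∎
  where open ≡-Reasoning

coeff-basis : ∀ d k i → coeff ((X ^ₚ k) ⊛ ((one ⊕ X) ^ₚ (d ∸ 2 * k))) i ≡ + basisCoeff d k i
coeff-basis d zero    i       = trans (one⊛ ((one ⊕ X) ^ₚ d) i) (coeff-[1+X]^ d i)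
coeff-basis d (suc k) zero    = X^[1+k]⊛ k ((one ⊕ X) ^ₚ (d ∸ 2 * suc k)) 0
coeff-basis d (suc k) (suc i) = begin
    coeff ((X ^ₚ suc k) ⊛ ((one ⊕ X) ^ₚ (d ∸ 2 * suc k))) (suc i)
  ≡⟨ X^[1+k]⊛ k ((one ⊕ X) ^ₚ (d ∸ 2 * suc k)) (suc i) ⟩
    coeff ((X ^ₚ k) ⊛ ((one ⊕ X) ^ₚ (d ∸ 2 * suc k))) i
  ≡⟨ cong (λ e → coeff ((X ^ₚ k) ⊛ ((one ⊕ X) ^ₚ e)) i) d∸2[1+k]≡d∸2∸2k ⟩
    coeff ((X ^ₚ k) ⊛ ((one ⊕ X) ^ₚ (d ∸ 2 ∸ 2 * k))) i
  ≡⟨ coeff-basis (d ∸ 2) k i ⟩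
    + basisCoeff (d ∸ 2) k i
  ∎
  where
  open ≡-Reasoning
  d∸2[1+k]≡d∸2∸2k : d ∸ 2 * suc k ≡ d ∸ 2 ∸ 2 * k
  d∸2[1+k]≡d∸2∸2k = trans (cong (d ∸_) (*-suc 2 k)) (sym (∸-+-assoc d 2 (2 * k)))

coeff-Σₚ : ∀ m (f : ℕ → Poly) (g : ℕ → ℕ) i → (∀ k → coeff (f k) i ≡ + g k) →
  coeff (Σₚ[k≤ m ] f) i ≡ + sumBelow (suc m) g
coeff-Σₚ m f g i eq = go (suc m) (λ k → k)
  where
  go : ∀ n h → coeff (foldr (λ k acc → f k ⊕ acc) [] (applyUpTo h n)) i ≡ + sumBelow n (λ k → g (h k))
  go zero    h = refl
  go (suc n) h = begin
      coeff (f (h 0) ⊕ foldr (λ k acc → f k ⊕ acc) [] (applyUpTo (λ k → h (suc k)) n)) i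
    ≡⟨ coeff-⊕ (f (h 0)) _ i ⟩
      coeff (f (h 0)) i ℤ.+ coeff (foldr (λ k acc → f k ⊕ acc) [] (applyUpTo (λ k → h (suc k)) n)) i
    ≡⟨ cong₂ ℤ._+_ (eq (h 0)) (go n (λ k → h (suc k))) ⟩
      + g (h 0) ℤ.+ + sumBelow n (λ k → g (h (suc k)))
    ≡⟨ ℤ.pos-+ (g (h 0)) _ ⟨
      + sumBelow (suc n) (λ k → g (h k))
    ∎
    where open ≡-Reasoning

coeff-gammaExpansion : ∀ d c i →
  coeff (gammaExpansion d c) i ≡ + sumBelow (suc (d / 2)) (λ k → c k * basisCoeff d k i)
coeff-gammaExpansion d c i =
  coeff-Σₚ (d / 2) (λ k → + c k ·ₚ basis k) (λ k → c k * basisCoeff d k i) i λ k → begin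
    coeff (+ c k ·ₚ ((X ^ₚ k) ⊛ ((one ⊕ X) ^ₚ (d ∸ 2 * k)))) i
  ≡⟨ coeff-·ₚ (+ c k) (basis k) i ⟩
    + c k ℤ.* coeff ((X ^ₚ k) ⊛ ((one ⊕ X) ^ₚ (d ∸ 2 * k))) i
  ≡⟨ cong (+ c k ℤ.*_) (coeff-basis d k i) ⟩
    + c k ℤ.* + basisCoeff d k i
  ≡⟨ ℤ.pos-* (c k) (basisCoeff d k i) ⟨
    + (c k * basisCoeff d k i)
  ∎
  where
  open ≡-Reasoning
  basis : ℕ → Poly
  basis k = (X ^ₚ k) ⊛ ((one ⊕ X) ^ₚ (d ∸ 2 * k))

k≤d/2⇒2k≤d : ∀ d k → k < suc (d / 2) → 2 * k ≤ d
k≤d/2⇒2k≤d d k (s≤s k≤d/2) = begin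
  2 * k        ≤⟨ *-monoʳ-≤ 2 k≤d/2 ⟩
  2 * (d / 2)  ≡⟨ *-comm 2 (d / 2) ⟩
  d / 2 * 2    ≤⟨ m/n*n≤m d 2 ⟩
  d            ∎
  where open ≤-Reasoning

d<2[1+d/2] : ∀ d → d < 2 * suc (d / 2)
d<2[1+d/2] d = begin-strict
  d                  ≡⟨ m≡m%n+[m/n]*n d 2 ⟩
  d % 2 + d / 2 * 2  <⟨ +-monoˡ-< (d / 2 * 2) (m%n<n d 2) ⟩
  2 + d / 2 * 2      ≡⟨ cong (λ x → 2 + x) (*-comm (d / 2) 2) ⟩
  2 + 2 * (d / 2)    ≡⟨ *-suc 2 (d / 2) ⟨
  2 * suc (d / 2)    ∎
  where open ≤-Reasoning

gammaExpansion-symmetric : ∀ d c → SymmetricOf d (gammaExpansion d c)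
gammaExpansion-symmetric d c = vanish , reflect
  where
  vanish : ∀ i → d < i → coeff (gammaExpansion d c) i ≡ + 0
  vanish i d<i = trans (coeff-gammaExpansion d c i) (cong +_ (sumBelow-zero (suc (d / 2)) _ λ k k≤d/2 →
    trans (cong (c k *_) (basisCoeff-vanish d k i (k≤d/2⇒2k≤d d k k≤d/2) d<i)) (*-zeroʳ (c k))))
  reflect : ∀ i → i ≤ d → coeff (gammaExpansion d c) i ≡ coeff (gammaExpansion d c) (d ∸ i)
  reflect i i≤d = begin
      coeff (gammaExpansion d c) i
    ≡⟨ coeff-gammaExpansion d c i ⟩
      + sumBelow (suc (d / 2)) (λ k → c k * basisCoeff d k i)
    ≡⟨ cong +_ (sumBelow-cong (suc (d / 2)) λ k k≤d/2 →
         cong (c k *_) (basisCoeff-sym d k i (k≤d/2⇒2k≤d d k k≤d/2) i≤d)) ⟩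
      + sumBelow (suc (d / 2)) (λ k → c k * basisCoeff d k (d ∸ i))
    ≡⟨ coeff-gammaExpansion d c (d ∸ i) ⟨
      coeff (gammaExpansion d c) (d ∸ i)
    ∎
    where open ≡-Reasoning

coeff-gammaExpansion-γ : ∀ d i → coeff (gammaExpansion d (γ d)) i ≡ + γcoeff d i
coeff-gammaExpansion-γ d i = trans (coeff-gammaExpansion d (γ d) i) (cong +_ (sym
  (sumBelow-γ-extend d (λ k → basisCoeff d k i) (d<2[1+d/2] d) (s≤s (m/n≤m d 2)))))

-- Statistics of permutations built by inserting the maximum

indicator : Bool → ℕ
indicator b = if b then 1 else 0

sumOver : (A → ℕ) → List A → ℕ
sumOver f xs = sum (map f xs)

sumOver-cong : ∀ (xs : List A) {f g : A → ℕ} → (∀ x → x ∈ xs → f x ≡ g x) → sumOver f xs ≡ sumOver g xs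
sumOver-cong []       eq = refl
sumOver-cong (x ∷ xs) eq = cong₂ _+_ (eq x (here refl)) (sumOver-cong xs (λ y y∈xs → eq y (there y∈xs)))

sumOver-zero : ∀ (xs : List A) (f : A → ℕ) → (∀ x → x ∈ xs → f x ≡ 0) → sumOver f xs ≡ 0
sumOver-zero []       f eq = refl
sumOver-zero (x ∷ xs) f eq rewrite eq x (here refl) = sumOver-zero xs f (λ y y∈xs → eq y (there y∈xs))

sumOver-++ : ∀ (f : A → ℕ) xs ys → sumOver f (xs ++ ys) ≡ sumOver f xs + sumOver f ys
sumOver-++ f []       ys = refl
sumOver-++ f (x ∷ xs) ys = trans (cong (_+_ (f x)) (sumOver-++ f xs ys)) (sym (+-assoc (f x) _ _))

sumOver-distrib-+ : ∀ (f g : A → ℕ) xs → sumOver (λ x → f x + g x) xs ≡ sumOver f xs + sumOver g xs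
sumOver-distrib-+ f g []       = refl
sumOver-distrib-+ f g (x ∷ xs) rewrite sumOver-distrib-+ f g xs =
  +-interchange (f x) (g x) (sumOver f xs) (sumOver g xs)

sumOver-distribˡ-* : ∀ c (f : A → ℕ) xs → sumOver (λ x → c * f x) xs ≡ c * sumOver f xs
sumOver-distribˡ-* c f []       = sym (*-zeroʳ c)
sumOver-distribˡ-* c f (x ∷ xs) rewrite sumOver-distribˡ-* c f xs = sym (*-distribˡ-+ c (f x) _)

sumOver-↭ : ∀ (f : A → ℕ) {xs ys} → xs ↭ ys → sumOver f xs ≡ sumOver f ys
sumOver-↭ f xs↭ys = sum-↭ (↭.map⁺ f xs↭ys)

sumOver-map : ∀ (f : B → ℕ) (g : A → B) xs → sumOver f (map g xs) ≡ sumOver (λ x → f (g x)) xs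
sumOver-map f g []       = refl
sumOver-map f g (x ∷ xs) = cong (_+_ (f (g x))) (sumOver-map f g xs)

sumOver-concatMap : ∀ (f : B → ℕ) (g : A → List B) xs →
  sumOver f (concatMap g xs) ≡ sumOver (λ x → sumOver f (g x)) xs
sumOver-concatMap f g []       = refl
sumOver-concatMap f g (x ∷ xs) =
  trans (sumOver-++ f (g x) (concatMap g xs)) (cong (_+_ (sumOver f (g x))) (sumOver-concatMap f g xs))

≡ᵇ-true⇒≡ : ∀ {m n} → (m ≡ᵇ n) ≡ true → m ≡ n
≡ᵇ-true⇒≡ {m} {n} eq = ≡ᵇ⇒≡ m n (Equivalence.from T-≡ eq)

<ᵇ-true⇒< : ∀ {m n} → (m <ᵇ n) ≡ true → m < n
<ᵇ-true⇒< {m} {n} eq = <ᵇ⇒< m n (Equivalence.from T-≡ eq)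

≡⇒≡ᵇ-true : ∀ {m n} → m ≡ n → (m ≡ᵇ n) ≡ true
≡⇒≡ᵇ-true {m} {n} = dec-true (m ≟ n)

≢⇒≡ᵇ-false : ∀ {m n} → m ≢ n → (m ≡ᵇ n) ≡ false
≢⇒≡ᵇ-false {m} {n} = dec-false (m ≟ n)

<⇒<ᵇ-true : ∀ {m n} → m < n → (m <ᵇ n) ≡ true
<⇒<ᵇ-true {m} {n} = dec-true (m <? n)

≥⇒<ᵇ-false : ∀ {m n} → n ≤ m → (m <ᵇ n) ≡ false
≥⇒<ᵇ-false {m} {n} n≤m = dec-false (m <? n) (≤⇒≯ n≤m)

countPairs : (ℕ → ℕ → Bool) → List ℕ → ℕ
countPairs p []          = 0
countPairs p (x ∷ [])    = 0
countPairs p (x ∷ y ∷ l) = indicator (p x y) + countPairs p (y ∷ l)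

ascents : List ℕ → ℕ
ascents = countPairs _<ᵇ_

successions : List ℕ → ℕ
successions = countPairs (λ x y → y ≡ᵇ suc x)

plainAscents : List ℕ → ℕ
plainAscents = countPairs (λ x y → (x <ᵇ y) ∧ not (y ≡ᵇ suc x))

descentsFrom : ℕ → List ℕ → ℕ
descentsFrom m = countPairs (λ x y → not (x <ᵇ y) ∧ (m ≡ᵇ x))

otherDescents : ℕ → List ℕ → ℕ
otherDescents m = countPairs (λ x y → not (x <ᵇ y) ∧ not (m ≡ᵇ x))

endsWith : ℕ → List ℕ → Bool
endsWith m []          = false
endsWith m (x ∷ [])    = m ≡ᵇ x
endsWith m (x ∷ y ∷ l) = endsWith m (y ∷ l)

endsWith-above : ∀ m l → All (_≤ m) l → endsWith (suc m) l ≡ false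
endsWith-above m []          _         = refl
endsWith-above m (x ∷ [])    (x≤m ∷ _) = ≢⇒≡ᵇ-false (λ 1+m≡x → 1+n≰n (subst (_≤ m) (sym 1+m≡x) x≤m))
endsWith-above m (x ∷ y ∷ l) (_ ∷ ps)  = endsWith-above m (y ∷ l) ps

insertions : ℕ → List ℕ → List (List ℕ)
insertions v []       = (v ∷ []) ∷ []
insertions v (x ∷ xs) = (v ∷ x ∷ xs) ∷ map (x ∷_) (insertions v xs)

-- A weight of a permutation of [0, m] through its numbers of ascents and successions and whether it ends with m.
Weight : Set
Weight = ℕ → ℕ → Bool → ℕ

weigh : ℕ → Weight → List ℕ → ℕ
weigh m w π = w (ascents π) (successions π) (endsWith m π)

successions-are-ascents : ∀ x y → (y ≡ᵇ suc x) ≡ true → (x <ᵇ y) ≡ false → ⊥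
successions-are-ascents x y y≡ᵇ1+x x<ᵇy =
  subst T x<ᵇy (<⇒<ᵇ {x} {y} (≤-reflexive (sym (≡ᵇ-true⇒≡ y≡ᵇ1+x))))

module Stats (m : ℕ) (l : List ℕ) where
  nAsc nSucc nPlain nFromMax nOther : ℕ
  nAsc     = ascents l
  nSucc    = successions l
  nPlain   = plainAscents l
  nFromMax = descentsFrom m l
  nOther   = otherDescents m l
  ends : Bool
  ends = endsWith m l

private
  n*f[1+[n∸1]]≡n*f[n] : ∀ n (f : ℕ → ℕ) → n * f (suc (n ∸ 1)) ≡ n * f n
  n*f[1+[n∸1]]≡n*f[n] zero    f = refl
  n*f[1+[n∸1]]≡n*f[n] (suc n) f = refl

  into₂ : ∀ x t s c d o → x + (t + s + c + d + o) ≡ t + (x + s) + c + d + o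
  into₂ = solve-∀

  into₃ : ∀ x t s c d o → x + (t + s + c + d + o) ≡ t + s + (x + c) + d + o
  into₃ = solve-∀

  into₄ : ∀ x t s c d o → x + (t + s + c + d + o) ≡ t + s + c + (x + d) + o
  into₄ = solve-∀

  into₅ : ∀ x t s c d o → x + (t + s + c + d + o) ≡ t + s + c + d + (x + o)
  into₅ = solve-∀

-- Inserting 1 + m after the head x: at the end it creates an ascent, which is a succession iff the list ends
-- with m; inside an ascent it keeps the number of ascents and breaks a succession; inside a descent (u, u′) it
-- creates the ascent (u, 1 + m), which is a succession iff u = m.
sumOver-insertions-tail : ∀ m (w : Weight) x xs → All (_≤ m) (x ∷ xs) →
  let open Stats m (x ∷ xs) in
  sumOver (λ c → weigh (suc m) w (x ∷ c)) (insertions (suc m) xs)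
  ≡ w (suc nAsc) (nSucc + indicator ends) true + nSucc * w nAsc (nSucc ∸ 1) false + nPlain * w nAsc nSucc false
    + nFromMax * w (suc nAsc) (suc nSucc) false + nOther * w (suc nAsc) nSucc false
sumOver-insertions-tail m w x [] (x≤m ∷ _)
  rewrite <⇒<ᵇ-true (s≤s x≤m) | ≡⇒≡ᵇ-true (refl {x = m}) | +-identityʳ (indicator (m ≡ᵇ x)) =
  pad (w 1 (indicator (m ≡ᵇ x)) true)
  where
  pad : ∀ t → t + 0 ≡ t + 0 + 0 + 0 + 0
  pad = solve-∀
sumOver-insertions-tail m w x (y ∷ ys) (x≤m ∷ y≤m ∷ ps)
  rewrite sumOver-map (λ c → weigh (suc m) w (x ∷ c)) (y ∷_) (insertions (suc m) ys)
        | <⇒<ᵇ-true (s≤s x≤m)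
        | ≥⇒<ᵇ-false {suc m} {y} (m≤n⇒m≤1+n y≤m)
        | ≢⇒≡ᵇ-false {y} {2 + m} (λ y≡2+m → 1+n≰n (≤-trans (n≤1+n (suc m)) (subst (_≤ m) y≡2+m y≤m)))
        | endsWith-above m (y ∷ ys) (y≤m ∷ ps)
        | sumOver-insertions-tail m (λ a s f → w (indicator (x <ᵇ y) + a) (indicator (y ≡ᵇ suc x) + s) f)
                                  y ys (y≤m ∷ ps)
  with x <ᵇ y in x<ᵇy | y ≡ᵇ suc x in y≡ᵇ1+x | m ≡ᵇ x in m≡ᵇx
... | false | true  | _     = ⊥-elim (successions-are-ascents x y y≡ᵇ1+x x<ᵇy)
... | true  | _     | true  = ⊥-elim (<⇒≱ (<ᵇ-true⇒< x<ᵇy) (subst (y ≤_) (≡ᵇ-true⇒≡ m≡ᵇx) y≤m))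
... | true  | true  | false = trans
  (cong (λ z → g nSucc + (t + z + c + d + o)) (n*f[1+[n∸1]]≡n*f[n] nSucc g)) (into₂ (g nSucc) t (nSucc * g nSucc) c d o)
  where
  open Stats m (y ∷ ys)
  g : ℕ → ℕ
  g s = w (suc nAsc) s false
  t c d o : ℕ
  t = w (2 + nAsc) (suc (nSucc + indicator ends)) true
  c = nPlain * w (suc nAsc) (suc nSucc) false
  d = nFromMax * w (2 + nAsc) (2 + nSucc) false
  o = nOther * w (2 + nAsc) (suc nSucc) false
... | true  | false | false =
  into₃ (w (suc nAsc) nSucc false) (w (2 + nAsc) (nSucc + indicator ends) true) (nSucc * w (suc nAsc) (nSucc ∸ 1) false)
        (nPlain * w (suc nAsc) nSucc false) (nFromMax * w (2 + nAsc) (suc nSucc) false) (nOther * w (2 + nAsc) nSucc false)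
  where open Stats m (y ∷ ys)
... | false | false | true  =
  into₄ (w (suc nAsc) (suc nSucc) false) (w (suc nAsc) (nSucc + indicator ends) true) (nSucc * w nAsc (nSucc ∸ 1) false)
        (nPlain * w nAsc nSucc false) (nFromMax * w (suc nAsc) (suc nSucc) false) (nOther * w (suc nAsc) nSucc false)
  where open Stats m (y ∷ ys)
... | false | false | false =
  into₅ (w (suc nAsc) nSucc false) (w (suc nAsc) (nSucc + indicator ends) true) (nSucc * w nAsc (nSucc ∸ 1) false)
        (nPlain * w nAsc nSucc false) (nFromMax * w (suc nAsc) (suc nSucc) false) (nOther * w (suc nAsc) nSucc false)
  where open Stats m (y ∷ ys)

permsℕ : ℕ → List (List ℕ)
permsℕ zero    = [] ∷ []
permsℕ (suc m) = concatMap (insertions m) (permsℕ m)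

∈-insertions⁻ : ∀ v l c → c ∈ insertions v l → ∃₂ λ pre post → l ≡ pre ++ post × c ≡ pre ++ v ∷ post
∈-insertions⁻ v []       c (here refl) = [] , [] , refl , refl
∈-insertions⁻ v (x ∷ xs) c (here refl) = [] , x ∷ xs , refl , refl
∈-insertions⁻ v (x ∷ xs) c (there c∈) with ∈-map⁻ (x ∷_) c∈
... | c′ , c′∈ , refl with ∈-insertions⁻ v xs c′ c′∈
...   | pre , post , refl , refl = x ∷ pre , post , refl , refl

∈-permsℕ-suc⁻ : ∀ m π → π ∈ permsℕ (suc m) → ∃ λ π′ → π′ ∈ permsℕ m × π ∈ insertions m π′
∈-permsℕ-suc⁻ m π π∈ = find (∈-concatMap⁻ (insertions m) {xs = permsℕ m} π∈)

length-insert : ∀ (v : ℕ) pre post → length (pre ++ v ∷ post) ≡ suc (length (pre ++ post))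
length-insert v pre post rewrite List.length-++ pre {v ∷ post} | List.length-++ pre {post} = +-suc (length pre) _

All-insert : ∀ {P : A → Set} (v : A) pre post → P v → All P (pre ++ post) → All P (pre ++ v ∷ post)
All-insert v pre post pv ps = All.++⁺ (All.++⁻ˡ pre ps) (pv ∷ All.++⁻ʳ pre ps)

permsℕ-shape : ∀ n π → π ∈ permsℕ n → length π ≡ n × All (_< n) π
permsℕ-shape zero    π (here refl) = refl , []
permsℕ-shape (suc m) π π∈ with ∈-permsℕ-suc⁻ m π π∈
... | π′ , π′∈ , π∈ins with permsℕ-shape m π′ π′∈ | ∈-insertions⁻ m π′ π π∈ins
...   | len , bound | pre , post , refl , refl =
  trans (length-insert m pre post) (cong suc len) , All-insert m pre post ≤-refl (All.map m<n⇒m<1+n bound)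

occurrences : ℕ → List ℕ → ℕ
occurrences m = sumOver (λ x → indicator (m ≡ᵇ x))

occurrences-permsℕ : ∀ m π → π ∈ permsℕ (suc m) → occurrences m π ≡ 1
occurrences-permsℕ m π π∈ with ∈-permsℕ-suc⁻ m π π∈
... | π′ , π′∈ , π∈ins with permsℕ-shape m π′ π′∈ | ∈-insertions⁻ m π′ π π∈ins
...   | _ , bound | pre , post , refl , refl = begin
    occurrences m (pre ++ m ∷ post)
  ≡⟨ sumOver-++ _ pre (m ∷ post) ⟩
    occurrences m pre + (indicator (m ≡ᵇ m) + occurrences m post)
  ≡⟨ cong (λ b → occurrences m pre + (indicator b + occurrences m post)) (≡⇒≡ᵇ-true (refl {x = m})) ⟩
    occurrences m pre + suc (occurrences m post)
  ≡⟨ +-suc (occurrences m pre) _ ⟩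
    suc (occurrences m pre + occurrences m post)
  ≡⟨ cong suc (sumOver-++ _ pre post) ⟨
    suc (occurrences m (pre ++ post))
  ≡⟨ cong suc (sumOver-zero (pre ++ post) _ (λ x x∈ → cong indicator
       (≢⇒≡ᵇ-false (λ m≡x → <-irrefl (sym m≡x) (All.lookup bound x∈))))) ⟩
    1
  ∎
  where open ≡-Reasoning

ascents≡successions+plainAscents : ∀ l → ascents l ≡ successions l + plainAscents l
ascents≡successions+plainAscents []          = refl
ascents≡successions+plainAscents (x ∷ [])    = refl
ascents≡successions+plainAscents (x ∷ y ∷ l)
  with ascents≡successions+plainAscents (y ∷ l) | x <ᵇ y in x<ᵇy | y ≡ᵇ suc x in y≡ᵇ1+x
... | _  | false | true  = ⊥-elim (successions-are-ascents x y y≡ᵇ1+x x<ᵇy)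
... | ih | true  | true  = cong suc ih
... | ih | true  | false = trans (cong suc ih) (sym (+-suc _ _))
... | ih | false | false = ih

length≡pairTypes : ∀ m x xs →
  length xs ≡ successions (x ∷ xs) + plainAscents (x ∷ xs) + descentsFrom m (x ∷ xs) + otherDescents m (x ∷ xs)
length≡pairTypes m x []      = refl
length≡pairTypes m x (y ∷ l)
  with length≡pairTypes m y l | x <ᵇ y in x<ᵇy | y ≡ᵇ suc x in y≡ᵇ1+x | m ≡ᵇ x
... | _  | false | true  | _     = ⊥-elim (successions-are-ascents x y y≡ᵇ1+x x<ᵇy)
... | ih | true  | true  | _     = cong suc ih
... | ih | true  | false | _     = trans (cong suc ih) (bump₂ nSucc nPlain nFromMax nOther)
  where
  open Stats m (y ∷ l)
  bump₂ : ∀ s a d o → suc (s + a + d + o) ≡ s + suc a + d + o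
  bump₂ = solve-∀
... | ih | false | false | true  = trans (cong suc ih) (bump₃ nSucc nPlain nFromMax nOther)
  where
  open Stats m (y ∷ l)
  bump₃ : ∀ s a d o → suc (s + a + d + o) ≡ s + a + suc d + o
  bump₃ = solve-∀
... | ih | false | false | false = trans (cong suc ih) (bump₄ nSucc nPlain nFromMax nOther)
  where
  open Stats m (y ∷ l)
  bump₄ : ∀ s a d o → suc (s + a + d + o) ≡ s + a + d + suc o
  bump₄ = solve-∀

descentsFrom+endsWith≡occurrences : ∀ m x xs → All (_≤ m) (x ∷ xs) →
  descentsFrom m (x ∷ xs) + indicator (endsWith m (x ∷ xs)) ≡ occurrences m (x ∷ xs)
descentsFrom+endsWith≡occurrences m x []      _ = sym (+-identityʳ _)
descentsFrom+endsWith≡occurrences m x (y ∷ l) (_ ∷ y≤m ∷ ps)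
  with descentsFrom+endsWith≡occurrences m y l (y≤m ∷ ps) | m ≡ᵇ x in m≡ᵇx
... | ih | true rewrite ≥⇒<ᵇ-false {x} {y} (subst (y ≤_) (≡ᵇ-true⇒≡ m≡ᵇx) y≤m) = cong suc ih
... | ih | false with x <ᵇ y
...   | true  = ih
...   | false = ih

-- Inserting 1 + m into a permutation of [0, m] with a ascents, s successions and last entry m iff f:
-- in front, at the end, inside each succession, inside each of the a ∸ s other ascents, right after m
-- (possible unless f), and inside each of the remaining m ∸ a ∸ (1 ∸ [f]) descents.
insertMax : ℕ → Weight → Weight
insertMax m w a s f =
  w a s false + w (suc a) (s + indicator f) true + s * w a (s ∸ 1) false + (a ∸ s) * w a s false
  + (1 ∸ indicator f) * w (suc a) (suc s) false + (m ∸ a ∸ (1 ∸ indicator f)) * w (suc a) s false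

ascents∸successions≡plainAscents : ∀ l → ascents l ∸ successions l ≡ plainAscents l
ascents∸successions≡plainAscents l =
  trans (cong (_∸ successions l) (ascents≡successions+plainAscents l)) (m+n∸m≡n (successions l) _)

1∸endsWith≡descentsFrom : ∀ m x xs → x ∷ xs ∈ permsℕ (suc m) →
  1 ∸ indicator (endsWith m (x ∷ xs)) ≡ descentsFrom m (x ∷ xs)
1∸endsWith≡descentsFrom m x xs π∈ = begin
    1 ∸ indicator ends
  ≡⟨ cong (_∸ indicator ends) (occurrences-permsℕ m (x ∷ xs) π∈) ⟨
    occurrences m (x ∷ xs) ∸ indicator ends
  ≡⟨ cong (_∸ indicator ends) (descentsFrom+endsWith≡occurrences m x xs ≤m) ⟨
    nFromMax + indicator ends ∸ indicator ends
  ≡⟨ m+n∸n≡m nFromMax (indicator ends) ⟩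
    nFromMax
  ∎
  where
  open ≡-Reasoning
  open Stats m (x ∷ xs)
  ≤m : All (_≤ m) (x ∷ xs)
  ≤m = All.map s≤s⁻¹ (proj₂ (permsℕ-shape (suc m) (x ∷ xs) π∈))

m∸ascents∸descentsFrom≡otherDescents : ∀ m x xs → x ∷ xs ∈ permsℕ (suc m) →
  m ∸ ascents (x ∷ xs) ∸ descentsFrom m (x ∷ xs) ≡ otherDescents m (x ∷ xs)
m∸ascents∸descentsFrom≡otherDescents m x xs π∈ = begin
    m ∸ nAsc ∸ nFromMax
  ≡⟨ cong (λ n → n ∸ nAsc ∸ nFromMax) (trans (sym (suc-injective (proj₁ (permsℕ-shape (suc m) (x ∷ xs) π∈))))
                                             (length≡pairTypes m x xs)) ⟩
    nSucc + nPlain + nFromMax + nOther ∸ nAsc ∸ nFromMax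
  ≡⟨ cong (λ n → n + nFromMax + nOther ∸ nAsc ∸ nFromMax) (ascents≡successions+plainAscents (x ∷ xs)) ⟨
    nAsc + nFromMax + nOther ∸ nAsc ∸ nFromMax
  ≡⟨ cong (_∸ nFromMax) (trans (cong (_∸ nAsc) (+-assoc nAsc nFromMax nOther)) (m+n∸m≡n nAsc (nFromMax + nOther))) ⟩
    nFromMax + nOther ∸ nFromMax
  ≡⟨ m+n∸m≡n nFromMax nOther ⟩
    nOther
  ∎
  where
  open ≡-Reasoning
  open Stats m (x ∷ xs)

sumOver-insertions : ∀ m (w : Weight) π → π ∈ permsℕ (suc m) →
  sumOver (weigh (suc m) w) (insertions (suc m) π) ≡ weigh m (insertMax m w) π
sumOver-insertions m w [] π∈ with permsℕ-shape (suc m) [] π∈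
... | () , _
sumOver-insertions m w (x ∷ xs) π∈ with permsℕ-shape (suc m) (x ∷ xs) π∈
... | _ , x<1+m ∷ xs<1+m
  rewrite sumOver-map (weigh (suc m) w) (x ∷_) (insertions (suc m) xs)
        | ≥⇒<ᵇ-false {suc m} {x} (<⇒≤ x<1+m)
        | ≢⇒≡ᵇ-false {x} {2 + m}
            (λ x≡2+m → 1+n≰n (≤-trans (n≤1+n (suc m)) (subst (_≤ m) x≡2+m (s≤s⁻¹ x<1+m))))
        | endsWith-above m (x ∷ xs) (All.map s≤s⁻¹ (x<1+m ∷ xs<1+m))
        | sumOver-insertions-tail m w x xs (All.map s≤s⁻¹ (x<1+m ∷ xs<1+m))
        | ascents∸successions≡plainAscents (x ∷ xs)
        | 1∸endsWith≡descentsFrom m x xs π∈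
        | m∸ascents∸descentsFrom≡otherDescents m x xs π∈
  = assoc (w nAsc nSucc false) (w (suc nAsc) (nSucc + indicator ends) true) (nSucc * w nAsc (nSucc ∸ 1) false)
          (nPlain * w nAsc nSucc false) (nFromMax * w (suc nAsc) (suc nSucc) false) (nOther * w (suc nAsc) nSucc false)
  where
  open Stats m (x ∷ xs)
  assoc : ∀ x t s c d o → x + (t + s + c + d + o) ≡ x + t + s + c + d + o
  assoc = solve-∀

-- Counting permutations by ascents, successions and last entry

total : ℕ → Weight → ℕ
total m w = sumOver (weigh m w) (permsℕ (suc m))

total-cong : ∀ m {w w′ : Weight} → (∀ a s f → w a s f ≡ w′ a s f) → total m w ≡ total m w′
total-cong m eq = sumOver-cong (permsℕ (suc m)) (λ π _ → eq (ascents π) (successions π) (endsWith m π))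

total-zero : ∀ m → total m (λ _ _ _ → 0) ≡ 0
total-zero m = sumOver-zero (permsℕ (suc m)) _ (λ _ _ → refl)

total-+ : ∀ m (w w′ : Weight) → total m (λ a s f → w a s f + w′ a s f) ≡ total m w + total m w′
total-+ m w w′ = sumOver-distrib-+ (weigh m w) (weigh m w′) (permsℕ (suc m))

total-* : ∀ m k (w : Weight) → total m (λ a s f → k * w a s f) ≡ k * total m w
total-* m k w = sumOver-distribˡ-* k (weigh m w) (permsℕ (suc m))

total-suc : ∀ m (w : Weight) → total (suc m) w ≡ total m (insertMax m w)
total-suc m w = trans (sumOver-concatMap (weigh (suc m) w) (insertions (suc m)) (permsℕ (suc m)))
                      (sumOver-cong (permsℕ (suc m)) (sumOver-insertions m w))

exactly₂ : ℕ → ℕ → Weight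
exactly₂ A S a s _ = indicator ((a ≡ᵇ A) ∧ (s ≡ᵇ S))

exactly : ℕ → ℕ → Bool → Weight
exactly A S F a s f = indicator (does (f ≟ᵇ F) ∧ (a ≡ᵇ A) ∧ (s ≡ᵇ S))

permCount : ℕ → ℕ → ℕ → Bool → ℕ
permCount m A S F = total m (exactly A S F)

exactly-true+false : ∀ A S a s f → exactly A S true a s f + exactly A S false a s f ≡ exactly₂ A S a s f
exactly-true+false A S a s true  = +-identityʳ _
exactly-true+false A S a s false = refl

*-exactly₂-cong : ∀ {k k′} A S a s f → (a ≡ A → s ≡ S → k ≡ k′) →
  k * exactly₂ A S a s f ≡ k′ * exactly₂ A S a s f
*-exactly₂-cong {k} {k′} A S a s f eq with a ≡ᵇ A in a≡ᵇA | s ≡ᵇ S in s≡ᵇS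
... | true  | true  = cong (_* 1) (eq (≡ᵇ-true⇒≡ a≡ᵇA) (≡ᵇ-true⇒≡ s≡ᵇS))
... | true  | false = trans (*-zeroʳ k) (sym (*-zeroʳ k′))
... | false | _     = trans (*-zeroʳ k) (sym (*-zeroʳ k′))

insertMax-exactly-true : ∀ m A S a s f →
  insertMax m (exactly A S true) a s f ≡ exactly A S true (suc a) (s + indicator f) true
insertMax-exactly-true m A S a s f
  rewrite *-zeroʳ s | *-zeroʳ (a ∸ s) | *-zeroʳ (1 ∸ indicator f) | *-zeroʳ (m ∸ a ∸ (1 ∸ indicator f)) =
  trans (+-identityʳ _) (trans (+-identityʳ _) (trans (+-identityʳ _) (+-identityʳ _)))

permCount-true-0 : ∀ m S → permCount (suc m) 0 S true ≡ 0
permCount-true-0 m S = trans (total-suc m (exactly 0 S true))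
  (trans (total-cong m (insertMax-exactly-true m 0 S)) (total-zero m))

permCount-true-suc-0 : ∀ m A → permCount (suc m) (suc A) 0 true ≡ permCount m A 0 false
permCount-true-suc-0 m A = trans (total-suc m (exactly (suc A) 0 true))
  (total-cong m λ a s f → trans (insertMax-exactly-true m (suc A) 0 a s f) (pointwise a s f))
  where
  pointwise : ∀ a s f → exactly (suc A) 0 true (suc a) (s + indicator f) true ≡ exactly A 0 false a s f
  pointwise a s true  rewrite +-comm s 1 = cong indicator (∧-zeroʳ (a ≡ᵇ A))
  pointwise a s false rewrite +-identityʳ s = refl

permCount-true-suc-suc : ∀ m A S →
  permCount (suc m) (suc A) (suc S) true ≡ permCount m A (suc S) false + permCount m A S true
permCount-true-suc-suc m A S = begin
    permCount (suc m) (suc A) (suc S) true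
  ≡⟨ total-suc m (exactly (suc A) (suc S) true) ⟩
    total m (insertMax m (exactly (suc A) (suc S) true))
  ≡⟨ total-cong m (λ a s f → trans (insertMax-exactly-true m (suc A) (suc S) a s f) (pointwise a s f)) ⟩
    total m (λ a s f → exactly A (suc S) false a s f + exactly A S true a s f)
  ≡⟨ total-+ m (exactly A (suc S) false) (exactly A S true) ⟩
    permCount m A (suc S) false + permCount m A S true
  ∎
  where
  open ≡-Reasoning
  pointwise : ∀ a s f → exactly (suc A) (suc S) true (suc a) (s + indicator f) true
                      ≡ exactly A (suc S) false a s f + exactly A S true a s f
  pointwise a s true  rewrite +-comm s 1 = refl
  pointwise a s false rewrite +-identityʳ s = sym (+-identityʳ _)

-- Insertions of 1 + m right after m, resp. into another descent, that produce A ascents and S successions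
-- (both raise the ascent count by one, the first also the succession count).
afterMax : ℕ → ℕ → Weight
afterMax (suc A) (suc S) a s f = exactly A S false a s f
afterMax zero    S       a s f = 0
afterMax (suc A) zero    a s f = 0

intoDescent : ℕ → ℕ → ℕ → Weight
intoDescent m (suc A) S a s f = (m ∸ A) * exactly A S true a s f + (m ∸ A ∸ 1) * exactly A S false a s f
intoDescent m zero    S a s f = 0

afterMaxCount : ℕ → ℕ → ℕ → ℕ
afterMaxCount m (suc A) (suc S) = permCount m A S false
afterMaxCount m zero    S       = 0
afterMaxCount m (suc A) zero    = 0

intoDescentCount : ℕ → ℕ → ℕ → ℕ
intoDescentCount m (suc A) S = (m ∸ A) * permCount m A S true + (m ∸ A ∸ 1) * permCount m A S false
intoDescentCount m zero    S = 0

front+plainAscent : ∀ A S a s f →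
  exactly₂ A S a s f + (a ∸ s) * exactly₂ A S a s f ≡ (1 + (A ∸ S)) * exactly₂ A S a s f
front+plainAscent A S a s f = *-exactly₂-cong {suc (a ∸ s)} {suc (A ∸ S)} A S a s f λ { refl refl → refl }

intoSuccession : ∀ A S a s f → s * exactly₂ A S a (s ∸ 1) f ≡ suc S * exactly₂ A (suc S) a s f
intoSuccession A S a zero    f rewrite ∧-zeroʳ (a ≡ᵇ A) = sym (*-zeroʳ (suc S))
intoSuccession A S a (suc s) f = *-exactly₂-cong {suc s} {suc S} A S a s f λ { _ refl → refl }

afterMax-exactly₂ : ∀ A S a s f → (1 ∸ indicator f) * exactly₂ A S (suc a) (suc s) f ≡ afterMax A S a s f
afterMax-exactly₂ zero    S       a s f     = *-zeroʳ (1 ∸ indicator f)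
afterMax-exactly₂ (suc A) zero    a s f     rewrite ∧-zeroʳ (a ≡ᵇ A) = *-zeroʳ (1 ∸ indicator f)
afterMax-exactly₂ (suc A) (suc S) a s true  = refl
afterMax-exactly₂ (suc A) (suc S) a s false = +-identityʳ _

intoDescent-exactly₂ : ∀ m A S a s f →
  (m ∸ a ∸ (1 ∸ indicator f)) * exactly₂ A S (suc a) s f ≡ intoDescent m A S a s f
intoDescent-exactly₂ m zero    S a s f     = *-zeroʳ (m ∸ a ∸ (1 ∸ indicator f))
intoDescent-exactly₂ m (suc A) S a s true  = begin
    (m ∸ a) * exactly₂ A S a s true
  ≡⟨ *-exactly₂-cong {m ∸ a} {m ∸ A} A S a s true (λ { refl _ → refl }) ⟩
    (m ∸ A) * exactly₂ A S a s true
  ≡⟨ +-identityʳ _ ⟨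
    (m ∸ A) * exactly₂ A S a s true + 0
  ≡⟨ cong (_+_ ((m ∸ A) * exactly₂ A S a s true)) (*-zeroʳ (m ∸ A ∸ 1)) ⟨
    intoDescent m (suc A) S a s true
  ∎
  where open ≡-Reasoning
intoDescent-exactly₂ m (suc A) S a s false = begin
    (m ∸ a ∸ 1) * exactly₂ A S a s false
  ≡⟨ *-exactly₂-cong {m ∸ a ∸ 1} {m ∸ A ∸ 1} A S a s false (λ { refl _ → refl }) ⟩
    (m ∸ A ∸ 1) * exactly₂ A S a s false
  ≡⟨ cong (_+ (m ∸ A ∸ 1) * exactly₂ A S a s false) (*-zeroʳ (m ∸ A)) ⟨
    intoDescent m (suc A) S a s false
  ∎
  where open ≡-Reasoning

insertMax-exactly-false : ∀ m A S a s f → insertMax m (exactly A S false) a s f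
  ≡ (1 + (A ∸ S)) * (exactly A S true a s f + exactly A S false a s f)
    + suc S * (exactly A (suc S) true a s f + exactly A (suc S) false a s f)
    + afterMax A S a s f + intoDescent m A S a s f
insertMax-exactly-false m A S a s f
  rewrite exactly-true+false A S a s f | exactly-true+false A (suc S) a s f
        | sym (front+plainAscent A S a s f) | sym (intoSuccession A S a s f)
        | sym (afterMax-exactly₂ A S a s f) | sym (intoDescent-exactly₂ m A S a s f) =
  regroup (exactly₂ A S a s f) (s * exactly₂ A S a (s ∸ 1) f) ((a ∸ s) * exactly₂ A S a s f)
          ((1 ∸ indicator f) * exactly₂ A S (suc a) (suc s) f) ((m ∸ a ∸ (1 ∸ indicator f)) * exactly₂ A S (suc a) s f)
  where
  regroup : ∀ i x y z u → i + 0 + x + y + z + u ≡ i + y + x + z + u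
  regroup = solve-∀

total-afterMax : ∀ m A S → total m (afterMax A S) ≡ afterMaxCount m A S
total-afterMax m zero    S       = total-zero m
total-afterMax m (suc A) zero    = total-zero m
total-afterMax m (suc A) (suc S) = refl

total-intoDescent : ∀ m A S → total m (intoDescent m A S) ≡ intoDescentCount m A S
total-intoDescent m zero    S = total-zero m
total-intoDescent m (suc A) S = trans
  (total-+ m (λ a s f → (m ∸ A) * exactly A S true a s f) (λ a s f → (m ∸ A ∸ 1) * exactly A S false a s f))
  (cong₂ _+_ (total-* m (m ∸ A) (exactly A S true)) (total-* m (m ∸ A ∸ 1) (exactly A S false)))

total-*-+ : ∀ m k (w w′ : Weight) → total m (λ a s f → k * (w a s f + w′ a s f)) ≡ k * (total m w + total m w′)
total-*-+ m k w w′ = trans (total-* m k (λ a s f → w a s f + w′ a s f)) (cong (k *_) (total-+ m w w′))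

permCount-false : ∀ m A S → permCount (suc m) A S false
  ≡ (1 + (A ∸ S)) * (permCount m A S true + permCount m A S false)
    + suc S * (permCount m A (suc S) true + permCount m A (suc S) false)
    + afterMaxCount m A S + intoDescentCount m A S
permCount-false m A S = begin
    permCount (suc m) A S false
  ≡⟨ trans (total-suc m (exactly A S false)) (total-cong m (insertMax-exactly-false m A S)) ⟩
    total m (λ a s f → front a s f + succ a s f + afterMax A S a s f + intoDescent m A S a s f)
  ≡⟨ trans (total-+ m (λ a s f → front a s f + succ a s f + afterMax A S a s f) (intoDescent m A S))
           (cong₂ _+_ (total-+ m (λ a s f → front a s f + succ a s f) (afterMax A S)) (total-intoDescent m A S)) ⟩
    total m (λ a s f → front a s f + succ a s f) + total m (afterMax A S) + intoDescentCount m A S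
  ≡⟨ cong₂ (λ x y → x + y + intoDescentCount m A S) (total-+ m front succ) (total-afterMax m A S) ⟩
    total m front + total m succ + afterMaxCount m A S + intoDescentCount m A S
  ≡⟨ cong₂ (λ x y → x + y + afterMaxCount m A S + intoDescentCount m A S)
           (total-*-+ m (1 + (A ∸ S)) (exactly A S true) (exactly A S false))
           (total-*-+ m (suc S) (exactly A (suc S) true) (exactly A (suc S) false)) ⟩
    (1 + (A ∸ S)) * (permCount m A S true + permCount m A S false)
      + suc S * (permCount m A (suc S) true + permCount m A (suc S) false)
      + afterMaxCount m A S + intoDescentCount m A S
  ∎
  where
  open ≡-Reasoning
  front succ : Weight
  front a s f = (1 + (A ∸ S)) * (exactly A S true a s f + exactly A S false a s f)
  succ  a s f = suc S * (exactly A (suc S) true a s f + exactly A (suc S) false a s f)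

exactly-vanish : ∀ A S F a s f → ¬ (a ≡ A × s ≡ S) → exactly A S F a s f ≡ 0
exactly-vanish A S F a s f ne with a ≡ᵇ A in a≡ᵇA | s ≡ᵇ S in s≡ᵇS
... | true  | true  = ⊥-elim (ne (≡ᵇ-true⇒≡ a≡ᵇA , ≡ᵇ-true⇒≡ s≡ᵇS))
... | true  | false = cong indicator (∧-zeroʳ (does (f ≟ᵇ F)))
... | false | _     = cong indicator (∧-zeroʳ (does (f ≟ᵇ F)))

permCount-vanish : ∀ m A S F → (∀ π → π ∈ permsℕ (suc m) → ¬ (ascents π ≡ A × successions π ≡ S)) →
  permCount m A S F ≡ 0
permCount-vanish m A S F never = sumOver-zero (permsℕ (suc m)) _
  (λ π π∈ → exactly-vanish A S F (ascents π) (successions π) (endsWith m π) (never π π∈))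

ascents≤m : ∀ m π → π ∈ permsℕ (suc m) → ascents π ≤ m
ascents≤m m []       π∈ with permsℕ-shape (suc m) [] π∈
... | () , _
ascents≤m m (x ∷ xs) π∈ = begin
  ascents (x ∷ xs)                               ≡⟨ ascents≡successions+plainAscents (x ∷ xs) ⟩
  successions (x ∷ xs) + plainAscents (x ∷ xs)   ≤⟨ m≤m+n _ _ ⟩
  _ + descentsFrom m (x ∷ xs)                    ≤⟨ m≤m+n _ _ ⟩
  _ + otherDescents m (x ∷ xs)                   ≡⟨ length≡pairTypes m x xs ⟨
  length xs                                      ≡⟨ suc-injective (proj₁ (permsℕ-shape (suc m) (x ∷ xs) π∈)) ⟩
  m                                              ∎
  where open ≤-Reasoning

permCount-A<S : ∀ m A S F → A < S → permCount m A S F ≡ 0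
permCount-A<S m A S F A<S = permCount-vanish m A S F λ π _ (a≡A , s≡S) →
  <⇒≱ A<S (subst₂ _≤_ s≡S a≡A
    (subst (successions π ≤_) (sym (ascents≡successions+plainAscents π)) (m≤m+n _ _)))

permCount-m<A : ∀ m A S F → m < A → permCount m A S F ≡ 0
permCount-m<A m A S F m<A = permCount-vanish m A S F λ π π∈ (a≡A , _) →
  <⇒≱ m<A (subst (_≤ m) a≡A (ascents≤m m π π∈))

permCount-m<S : ∀ m A S F → m < S → permCount m A S F ≡ 0
permCount-m<S m A S F m<S with A <? S
... | yes A<S = permCount-A<S m A S F A<S
... | no  A≮S = permCount-m<A m A S F (<-≤-trans m<S (≮⇒≥ A≮S))

noSuccCount : ℕ → ℕ → Bool → ℕ
noSuccCount m a f = permCount m a 0 f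

noSuccCount-true-0 : ∀ k → noSuccCount (suc k) 0 true ≡ 0
noSuccCount-true-0 k = permCount-true-0 k 0

noSuccCount-true-suc : ∀ k a → noSuccCount (suc k) (suc a) true ≡ noSuccCount k a false
noSuccCount-true-suc = permCount-true-suc-0

-- Combinatorially: merging each of the s successions (u, u + 1) of a permutation of [0, k] into one entry
-- leaves a succession-free permutation of [0, k ∸ s], with s ascents fewer and the same last-entry status.
ClosedForm : ℕ → Set
ClosedForm k = ∀ s a f → permCount k (s + a) s f ≡ (k C s) * noSuccCount (k ∸ s) a f

closedForm-0 : ClosedForm 0
closedForm-0 zero    a f = sym (*-identityˡ (noSuccCount 0 a f))
closedForm-0 (suc s) a f = permCount-m<S 0 (suc s + a) (suc s) f z<s

s≮m⇒mC[1+s]≡0 : ∀ m s → ¬ s < m → m C suc s ≡ 0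
s≮m⇒mC[1+s]≡0 m s s≮m = k>n⇒nCk≡0 (s≤s (≮⇒≥ s≮m))

s+0<1+s : ∀ s → s + 0 < suc s
s+0<1+s s = s≤s (≤-reflexive (+-identityʳ s))

closedForm-true : ∀ m → ClosedForm m → ∀ s a →
  permCount (suc m) (suc s + a) (suc s) true ≡ (suc m C suc s) * noSuccCount (m ∸ s) a true
closedForm-true m cf s a = begin
    permCount (suc m) (suc s + a) (suc s) true
  ≡⟨ permCount-true-suc-suc m (s + a) s ⟩
    permCount m (s + a) (suc s) false + permCount m (s + a) s true
  ≡⟨ cong₂ _+_ (first-term a) (cf s a true) ⟩
    (m C suc s) * z + (m C s) * z
  ≡⟨ *-distribʳ-+ z (m C suc s) (m C s) ⟨
    (m C suc s + m C s) * z
  ≡⟨ cong (_* z) (trans (+-comm (m C suc s) (m C s)) (nCk+nC[k+1]≡[n+1]C[k+1] m s)) ⟩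
    (suc m C suc s) * z
  ∎
  where
  open ≡-Reasoning
  z : ℕ
  z = noSuccCount (m ∸ s) a true
  first-term : ∀ a → permCount m (s + a) (suc s) false ≡ (m C suc s) * noSuccCount (m ∸ s) a true
  first-term a with s <? m
  first-term zero    | yes s<m rewrite +-∸-assoc 1 s<m | noSuccCount-true-0 (m ∸ suc s) | *-zeroʳ (m C suc s) =
    permCount-A<S m (s + 0) (suc s) false (s+0<1+s s)
  first-term (suc a) | yes s<m rewrite +-∸-assoc 1 s<m | noSuccCount-true-suc (m ∸ suc s) a | +-suc s a =
    cf (suc s) a false
  first-term zero    | no s≮m rewrite s≮m⇒mC[1+s]≡0 m s s≮m = permCount-A<S m (s + 0) (suc s) false (s+0<1+s s)
  first-term (suc a) | no s≮m rewrite s≮m⇒mC[1+s]≡0 m s s≮m | +-suc s a =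
    trans (cf (suc s) a false) (cong (_* noSuccCount (m ∸ suc s) a false) (s≮m⇒mC[1+s]≡0 m s s≮m))

private
  m∸[2+s]≡m∸[1+s]∸1 : ∀ m s → m ∸ suc (suc s) ≡ m ∸ suc s ∸ 1
  m∸[2+s]≡m∸[1+s]∸1 m s = trans (cong (m ∸_) (+-comm 1 (suc s))) (sym (∸-+-assoc m (suc s) 1))

  m∸[s+1+a]≡m∸[1+s]∸a : ∀ m s a → m ∸ (s + suc a) ≡ m ∸ suc s ∸ a
  m∸[s+1+a]≡m∸[1+s]∸a m s a = trans (cong (m ∸_) (+-suc s a)) (sym (∸-+-assoc m (suc s) a))

  closedForm-algebra : ∀ a B B₂ c k T₁ F₁ T₂ F₂ u v T₃ F₃ → c * B₂ ≡ k * B →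
    (2 + a) * (B * T₁ + B * F₁) + c * (B₂ * T₂ + B₂ * F₂) + (u * (B * T₃) + v * (B * F₃))
    ≡ B * ((2 + a) * (T₁ + F₁) + 1 * (k * T₂ + k * F₂) + 0 + (u * T₃ + v * F₃))
  closedForm-algebra a B B₂ c k T₁ F₁ T₂ F₂ u v T₃ F₃ eq = begin
      (2 + a) * (B * T₁ + B * F₁) + c * (B₂ * T₂ + B₂ * F₂) + (u * (B * T₃) + v * (B * F₃))
    ≡⟨ factor a B B₂ c T₁ F₁ T₂ F₂ u v T₃ F₃ ⟩
      (2 + a) * (B * T₁ + B * F₁) + (c * B₂) * (T₂ + F₂) + (u * (B * T₃) + v * (B * F₃))
    ≡⟨ cong (λ x → (2 + a) * (B * T₁ + B * F₁) + x * (T₂ + F₂) + (u * (B * T₃) + v * (B * F₃))) eq ⟩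
      (2 + a) * (B * T₁ + B * F₁) + (k * B) * (T₂ + F₂) + (u * (B * T₃) + v * (B * F₃))
    ≡⟨ distribute a B k T₁ F₁ T₂ F₂ u v T₃ F₃ ⟩
      B * ((2 + a) * (T₁ + F₁) + 1 * (k * T₂ + k * F₂) + 0 + (u * T₃ + v * F₃))
    ∎
    where
    open ≡-Reasoning
    factor : ∀ a B B₂ c T₁ F₁ T₂ F₂ u v T₃ F₃ →
      (2 + a) * (B * T₁ + B * F₁) + c * (B₂ * T₂ + B₂ * F₂) + (u * (B * T₃) + v * (B * F₃))
      ≡ (2 + a) * (B * T₁ + B * F₁) + (c * B₂) * (T₂ + F₂) + (u * (B * T₃) + v * (B * F₃))
    factor = solve-∀
    distribute : ∀ a B k T₁ F₁ T₂ F₂ u v T₃ F₃ →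
      (2 + a) * (B * T₁ + B * F₁) + (k * B) * (T₂ + F₂) + (u * (B * T₃) + v * (B * F₃))
      ≡ B * ((2 + a) * (T₁ + F₁) + 1 * (k * T₂ + k * F₂) + 0 + (u * T₃ + v * F₃))
    distribute = solve-∀

-- The terms of permCount-false other than afterMaxCount. The closed form is used at m ∸ (1 + s) with one
-- succession, hence the strong induction.
closedForm-false-rest : ∀ m → (∀ {k} → k ≤ m → ClosedForm k) → ∀ s a →
  (1 + (suc s + a ∸ suc s)) * (permCount m (suc s + a) (suc s) true + permCount m (suc s + a) (suc s) false)
  + suc (suc s) * (permCount m (suc s + a) (suc (suc s)) true + permCount m (suc s + a) (suc (suc s)) false)
  + intoDescentCount m (suc s + a) (suc s)
  ≡ (m C suc s) * noSuccCount (m ∸ s) a false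
closedForm-false-rest m cf s zero
  rewrite m+n∸m≡n (suc s) 0
        | cf ≤-refl (suc s) 0 true | cf ≤-refl (suc s) 0 false
        | permCount-A<S m (suc s + 0) (suc (suc s)) true  (s≤s (s+0<1+s s))
        | permCount-A<S m (suc s + 0) (suc (suc s)) false (s≤s (s+0<1+s s))
        | permCount-A<S m (s + 0) (suc s) true  (s+0<1+s s)
        | permCount-A<S m (s + 0) (suc s) false (s+0<1+s s)
        | *-zeroʳ (suc (suc s)) | *-zeroʳ (m ∸ (s + 0)) | *-zeroʳ (m ∸ (s + 0) ∸ 1)
  with s <? m
... | yes s<m rewrite +-∸-assoc 1 s<m | permCount-false (m ∸ suc s) 0 0
        | permCount-A<S (m ∸ suc s) 0 1 true z<s | permCount-A<S (m ∸ suc s) 0 1 false z<s =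
  pad (m C suc s) (noSuccCount (m ∸ suc s) 0 true) (noSuccCount (m ∸ suc s) 0 false)
  where
  pad : ∀ B x y → 1 * (B * x + B * y) + 0 + 0 ≡ B * (1 * (x + y) + 0 + 0 + 0)
  pad = solve-∀
... | no s≮m rewrite s≮m⇒mC[1+s]≡0 m s s≮m = refl
closedForm-false-rest m cf s (suc a)
  rewrite m+n∸m≡n (suc s) (suc a)
        | cf ≤-refl (suc s) (suc a) true | cf ≤-refl (suc s) (suc a) false
        | +-suc s a
        | cf ≤-refl (suc (suc s)) a true | cf ≤-refl (suc (suc s)) a false
        | cf ≤-refl (suc s) a true | cf ≤-refl (suc s) a false
        | sym (+-suc s a)
  with s <? m
... | no s≮m rewrite s≮m⇒mC[1+s]≡0 m s s≮m | k>n⇒nCk≡0 {m} {2 + s} (s≤s (≤-trans (≮⇒≥ s≮m) (n≤1+n s)))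
        | *-zeroʳ (suc (suc s)) | *-zeroʳ (m ∸ (s + suc a)) | *-zeroʳ (m ∸ (s + suc a) ∸ 1)
        | *-zeroʳ (suc (suc a)) = refl
... | yes s<m rewrite +-∸-assoc 1 s<m | permCount-false (m ∸ suc s) (suc a) 0
        | cf (m∸n≤m m (suc s)) 1 a true | cf (m∸n≤m m (suc s)) 1 a false
        | nC1≡n (m ∸ suc s) | sym (m∸[2+s]≡m∸[1+s]∸1 m s) | m∸[s+1+a]≡m∸[1+s]∸a m s a =
  closedForm-algebra a (m C suc s) (m C suc (suc s)) (suc (suc s)) (m ∸ suc s)
    (noSuccCount (m ∸ suc s) (suc a) true) (noSuccCount (m ∸ suc s) (suc a) false)
    (noSuccCount (m ∸ suc (suc s)) a true) (noSuccCount (m ∸ suc (suc s)) a false)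
    (m ∸ suc s ∸ a) (m ∸ suc s ∸ a ∸ 1) (noSuccCount (m ∸ suc s) a true) (noSuccCount (m ∸ suc s) a false)
    (sym ([n∸k]*nCk≡[k+1]*nC[k+1] m (suc s)))

closedForm-suc : ∀ m → (∀ {k} → k ≤ m → ClosedForm k) → ClosedForm (suc m)
closedForm-suc m cf zero    a f     = sym (*-identityˡ (noSuccCount (suc m) a f))
closedForm-suc m cf (suc s) a true  = closedForm-true m (cf ≤-refl) s a
closedForm-suc m cf (suc s) a false = begin
    permCount (suc m) (suc s + a) (suc s) false
  ≡⟨ permCount-false m (suc s + a) (suc s) ⟩
    t₁ + t₂ + permCount m (s + a) s false + t₃
  ≡⟨ shuffle t₁ t₂ (permCount m (s + a) s false) t₃ ⟩
    permCount m (s + a) s false + (t₁ + t₂ + t₃)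
  ≡⟨ cong₂ _+_ (cf ≤-refl s a false) (closedForm-false-rest m cf s a) ⟩
    (m C s) * z + (m C suc s) * z
  ≡⟨ *-distribʳ-+ z (m C s) (m C suc s) ⟨
    (m C s + m C suc s) * z
  ≡⟨ cong (_* z) (nCk+nC[k+1]≡[n+1]C[k+1] m s) ⟩
    (suc m C suc s) * z
  ∎
  where
  open ≡-Reasoning
  z t₁ t₂ t₃ : ℕ
  z = noSuccCount (m ∸ s) a false
  t₁ = (1 + (suc s + a ∸ suc s)) * (permCount m (suc s + a) (suc s) true + permCount m (suc s + a) (suc s) false)
  t₂ = suc (suc s) * (permCount m (suc s + a) (suc (suc s)) true + permCount m (suc s + a) (suc (suc s)) false)
  t₃ = intoDescentCount m (suc s + a) (suc s)
  shuffle : ∀ x y u v → x + y + u + v ≡ u + (x + y + v)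
  shuffle = solve-∀

closedForm : ∀ k → ClosedForm k
closedForm = <-rec ClosedForm step
  where
  step : ∀ k → (∀ {j} → j < k → ClosedForm j) → ClosedForm k
  step zero    _  = closedForm-0
  step (suc m) ih = closedForm-suc m (λ k≤m → ih (s≤s k≤m))

permCount-1 : ∀ k a f → permCount k (suc a) 1 f ≡ k * noSuccCount (k ∸ 1) a f
permCount-1 k a f = trans (closedForm k 1 a f) (cong (_* noSuccCount (k ∸ 1) a f) (nC1≡n k))

-- The derangement polynomials

d : ℕ → ℕ → ℕ
d zero    zero    = 1
d zero    (suc i) = 0
d (suc m) zero    = 0
d (suc m) (suc a) = noSuccCount m a false

noSuccCount-true≡d : ∀ n a → noSuccCount n a true ≡ d n a
noSuccCount-true≡d zero    zero    = refl
noSuccCount-true≡d zero    (suc a) = refl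
noSuccCount-true≡d (suc n) zero    = noSuccCount-true-0 n
noSuccCount-true≡d (suc n) (suc a) = noSuccCount-true-suc n a

d-vanish : ∀ n i → n < i → d n i ≡ 0
d-vanish zero    (suc i) _         = refl
d-vanish (suc m) (suc a) (s≤s m<a) = permCount-m<A m a 0 false m<a

DRecurrence : ℕ → Set
DRecurrence n = ∀ a → d (2 + n) (suc a) ≡ suc a * d (suc n) (suc a) + (suc n ∸ a) * d (suc n) a + suc n * d n a

d-recurrence-0 : DRecurrence 0
d-recurrence-0 zero    = refl
d-recurrence-0 (suc a) rewrite *-zeroʳ a | *-zeroʳ (0 ∸ a) = refl

private
  d-recurrence-algebra : ∀ a q n x₁ y₂ dₙ x₀ y₁ → y₁ ≡ suc a * x₁ + suc q * x₀ + suc n * dₙ →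
    (2 + a) * (x₁ + y₂) + 1 * (suc n * dₙ + suc n * x₁) + 0 + (suc q * x₀ + q * y₁)
    ≡ (2 + a) * y₂ + suc q * y₁ + (2 + n) * x₁
  d-recurrence-algebra a q n x₁ y₂ dₙ x₀ y₁ eq = begin
      (2 + a) * (x₁ + y₂) + 1 * (suc n * dₙ + suc n * x₁) + 0 + (suc q * x₀ + q * y₁)
    ≡⟨ split a q n x₁ y₂ dₙ x₀ y₁ ⟩
      (2 + a) * y₂ + q * y₁ + (2 + n) * x₁ + (suc a * x₁ + suc q * x₀ + suc n * dₙ)
    ≡⟨ cong (_+_ ((2 + a) * y₂ + q * y₁ + (2 + n) * x₁)) eq ⟨
      (2 + a) * y₂ + q * y₁ + (2 + n) * x₁ + y₁
    ≡⟨ merge a q n x₁ y₂ y₁ ⟩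
      (2 + a) * y₂ + suc q * y₁ + (2 + n) * x₁
    ∎
    where
    open ≡-Reasoning
    split : ∀ a q n x₁ y₂ dₙ x₀ y₁ →
      (2 + a) * (x₁ + y₂) + 1 * (suc n * dₙ + suc n * x₁) + 0 + (suc q * x₀ + q * y₁)
      ≡ (2 + a) * y₂ + q * y₁ + (2 + n) * x₁ + (suc a * x₁ + suc q * x₀ + suc n * dₙ)
    split = solve-∀
    merge : ∀ a q n x₁ y₂ y₁ →
      (2 + a) * y₂ + q * y₁ + (2 + n) * x₁ + y₁ ≡ (2 + a) * y₂ + suc q * y₁ + (2 + n) * x₁
    merge = solve-∀

d-recurrence-suc : ∀ n → DRecurrence n → DRecurrence (suc n)
d-recurrence-suc n rec zero
  rewrite permCount-false (suc n) 0 0 | noSuccCount-true-0 n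
        | permCount-A<S (suc n) 0 1 true z<s | permCount-A<S (suc n) 0 1 false z<s
        | *-zeroʳ (2 + n) = +-identityʳ _
d-recurrence-suc n rec (suc a)
  rewrite permCount-false (suc n) (suc a) 0 | noSuccCount-true-suc n a
        | permCount-1 (suc n) a true | permCount-1 (suc n) a false
        | noSuccCount-true≡d n a | noSuccCount-true≡d (suc n) a
  with a ≤? n
... | yes a≤n rewrite +-∸-assoc 1 a≤n =
  d-recurrence-algebra a (n ∸ a) n (d (suc n) (suc a)) (d (2 + n) (2 + a)) (d n a) (d (suc n) a) (d (2 + n) (suc a))
          (subst (λ c → d (2 + n) (suc a) ≡ suc a * d (suc n) (suc a) + c * d (suc n) a + suc n * d n a)
                 (+-∸-assoc 1 a≤n) (rec a))
... | no a≰n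
  rewrite m≤n⇒m∸n≡0 (≰⇒> a≰n) | d-vanish (suc n) (suc a) (s≤s (≰⇒> a≰n)) | d-vanish n a (≰⇒> a≰n) =
  vanish a n (d (2 + n) (2 + a)) (d (suc n) a) (d (2 + n) (suc a))
  where
  vanish : ∀ a n y x₀ y₁ → (2 + a) * (0 + y) + 1 * (suc n * 0 + suc n * 0) + 0 + (0 * x₀ + 0 * y₁)
                          ≡ (2 + a) * y + 0 * y₁ + (2 + n) * 0
  vanish = solve-∀

d-recurrence : ∀ n → DRecurrence n
d-recurrence zero    = d-recurrence-0
d-recurrence (suc n) = d-recurrence-suc n (d-recurrence n)

d≡γcoeff : ∀ n i → d n i ≡ γcoeff n i
d≡γcoeff n = proj₁ (twoSteps n)
  where
  twoSteps : ∀ n → (∀ i → d n i ≡ γcoeff n i) × (∀ i → d (suc n) i ≡ γcoeff (suc n) i)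
  twoSteps zero    = (λ { zero → refl ; (suc i) → refl }) , (λ { zero → refl ; (suc i) → refl })
  twoSteps (suc n) with twoSteps n
  ... | dₙ≡ , dₙ₊₁≡ = dₙ₊₁≡ , dₙ₊₂≡
    where
    dₙ₊₂≡ : ∀ i → d (2 + n) i ≡ γcoeff (2 + n) i
    dₙ₊₂≡ zero    = sym (γcoeff[2+n,0]≡0 n)
    dₙ₊₂≡ (suc a) = begin
        d (2 + n) (suc a)
      ≡⟨ d-recurrence n a ⟩
        suc a * d (suc n) (suc a) + (suc n ∸ a) * d (suc n) a + suc n * d n a
      ≡⟨ cong₂ _+_ (cong₂ _+_ (cong (suc a *_) (dₙ₊₁≡ (suc a))) (cong ((suc n ∸ a) *_) (dₙ₊₁≡ a)))
                   (cong (suc n *_) (dₙ≡ a)) ⟩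
        suc a * γcoeff (suc n) (suc a) + (suc n ∸ a) * γcoeff (suc n) a + suc n * γcoeff n a
      ≡⟨ γcoeff-recurrence n a ⟨
        γcoeff (2 + n) (suc a)
      ∎
      where open ≡-Reasoning

-- Comparison with the permutations of the statement

Unique-insert : ∀ (v : A) pre post → v ∉ pre ++ post → Unique (pre ++ post) → Unique (pre ++ v ∷ post)
Unique-insert v []        post v∉ u        = All.¬Any⇒All¬ post v∉ ∷ u
Unique-insert v (x ∷ pre) post v∉ (x∉ ∷ u) =
  All-insert v pre post (λ x≡v → v∉ (here (sym x≡v))) x∉ ∷ Unique-insert v pre post (λ v∈ → v∉ (there v∈)) u

All-delete : ∀ {P : A → Set} (v : A) pre post → All P (pre ++ v ∷ post) → All P (pre ++ post)
All-delete v []        post (_ ∷ ps)  = ps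
All-delete v (y ∷ pre) post (py ∷ ps) = py ∷ All-delete v pre post ps

Unique-delete : ∀ (v : A) pre post → Unique (pre ++ v ∷ post) → Unique (pre ++ post) × v ∉ pre ++ post
Unique-delete v []        post (v∉ ∷ u) = u , All.All¬⇒¬Any v∉
Unique-delete v (x ∷ pre) post (x∉ ∷ u) with Unique-delete v pre post u
... | u′ , v∉ = All-delete v pre post x∉ ∷ u′ , λ
  { (here v≡x) → All.lookup (All.++⁻ʳ pre x∉) (here refl) (sym v≡x)
  ; (there v∈) → v∉ v∈ }

Unique-concatMap : ∀ (f : A → List B) xs → Unique xs → (∀ x → x ∈ xs → Unique (f x)) →
  (∀ x y c → x ∈ xs → y ∈ xs → c ∈ f x → c ∈ f y → x ≡ y) → Unique (concatMap f xs)
Unique-concatMap f []       _          _     _     = []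
Unique-concatMap f (x ∷ xs) (x∉ ∷ u) uniq inj =
  Unique.++⁺ (uniq x (here refl))
             (Unique-concatMap f xs u (λ y y∈ → uniq y (there y∈))
                               (λ y z c y∈ z∈ → inj y z c (there y∈) (there z∈)))
             disjoint
  where
  disjoint : ∀ {c} → ¬ (c ∈ f x × c ∈ concatMap f xs)
  disjoint (c∈fx , c∈rest) with find (∈-concatMap⁻ f {xs = xs} c∈rest)
  ... | y , y∈ , c∈fy = All.lookup x∉ y∈ (inj x y _ (here refl) (there y∈) c∈fx c∈fy)

IsPermℕ : ℕ → List ℕ → Set
IsPermℕ n l = length l ≡ n × All (_< n) l × Unique l

∈-insertions⁺ : ∀ v pre post → pre ++ v ∷ post ∈ insertions v (pre ++ post)
∈-insertions⁺ v []        []       = here refl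
∈-insertions⁺ v []        (x ∷ xs) = here refl
∈-insertions⁺ v (x ∷ pre) post     = there (∈-map⁺ (x ∷_) (∈-insertions⁺ v pre post))

split-at-∉ : ∀ (v : A) pre pre′ post post′ → v ∉ pre → v ∉ pre′ →
  pre ++ v ∷ post ≡ pre′ ++ v ∷ post′ → pre ≡ pre′ × post ≡ post′
split-at-∉ v []        []         post post′ _   _    refl = refl , refl
split-at-∉ v []        (x ∷ pre′) post post′ _   v∉′  eq   = ⊥-elim (v∉′ (here (proj₁ (List.∷-injective eq))))
split-at-∉ v (x ∷ pre) []         post post′ v∉  _    eq   = ⊥-elim (v∉ (here (sym (proj₁ (List.∷-injective eq)))))
split-at-∉ v (x ∷ pre) (y ∷ pre′) post post′ v∉  v∉′  eq with List.∷-injective eq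
... | refl , eq′
  with split-at-∉ v pre pre′ post post′ (λ v∈ → v∉ (there v∈)) (λ v∈ → v∉′ (there v∈)) eq′
...   | refl , refl = refl , refl

insertions-injective : ∀ v x y c → v ∉ x → v ∉ y → c ∈ insertions v x → c ∈ insertions v y → x ≡ y
insertions-injective v x y c v∉x v∉y c∈x c∈y with ∈-insertions⁻ v x c c∈x | ∈-insertions⁻ v y c c∈y
... | pre , post , refl , refl | pre′ , post′ , refl , eq
  with split-at-∉ v pre pre′ post post′ (λ v∈ → v∉x (∈-++⁺ˡ v∈)) (λ v∈ → v∉y (∈-++⁺ˡ v∈)) eq
...   | refl , refl = refl

Unique-insertions : ∀ v x → v ∉ x → Unique (insertions v x)
Unique-insertions v []       _  = [] ∷ []
Unique-insertions v (y ∷ ys) v∉ =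
  All.¬Any⇒All¬ _ head∉ ∷
  Unique.map⁺ (λ eq → proj₂ (List.∷-injective eq)) (Unique-insertions v ys (λ v∈ → v∉ (there v∈)))
  where
  head∉ : (v ∷ y ∷ ys) ∉ map (y ∷_) (insertions v ys)
  head∉ c∈ with ∈-map⁻ (y ∷_) c∈
  ... | _ , _ , eq = v∉ (here (proj₁ (List.∷-injective eq)))

max∉permsℕ : ∀ m π → π ∈ permsℕ m → m ∉ π
max∉permsℕ m π π∈ m∈ = <-irrefl refl (All.lookup (proj₂ (permsℕ-shape m π π∈)) m∈)

permsℕ-sound : ∀ n π → π ∈ permsℕ n → IsPermℕ n π
permsℕ-sound zero    π (here refl) = refl , [] , []
permsℕ-sound (suc m) π π∈ with ∈-permsℕ-suc⁻ m π π∈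
... | π′ , π′∈ , π∈ins with permsℕ-sound m π′ π′∈ | ∈-insertions⁻ m π′ π π∈ins
...   | _ , _ , u | pre , post , refl , refl =
  proj₁ (permsℕ-shape (suc m) π π∈) , proj₂ (permsℕ-shape (suc m) π π∈) ,
  Unique-insert m pre post (max∉permsℕ m π′ π′∈) u

permsℕ-unique : ∀ n → Unique (permsℕ n)
permsℕ-unique zero    = [] ∷ []
permsℕ-unique (suc m) = Unique-concatMap (insertions m) (permsℕ m) (permsℕ-unique m)
  (λ π π∈ → Unique-insertions m π (max∉permsℕ m π π∈))
  (λ π π′ c π∈ π′∈ → insertions-injective m π π′ c (max∉permsℕ m π π∈) (max∉permsℕ m π′ π′∈))

All<1+m∧∉⇒All<m : ∀ m l → All (_< suc m) l → m ∉ l → All (_< m) l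
All<1+m∧∉⇒All<m m []      _              _  = []
All<1+m∧∉⇒All<m m (x ∷ l) (x<1+m ∷ l<1+m) m∉ =
  ≤∧≢⇒< (s≤s⁻¹ x<1+m) (λ x≡m → m∉ (here (sym x≡m))) ∷
  All<1+m∧∉⇒All<m m l l<1+m (λ m∈ → m∉ (there m∈))

pigeonhole : ∀ m l → Unique l → All (_< m) l → length l ≤ m
pigeonhole zero    []      _ _          = z≤n
pigeonhole zero    (x ∷ l) _ (() ∷ _)
pigeonhole (suc m) l       u l<1+m with m ∈? l
... | no  m∉ = m≤n⇒m≤1+n (pigeonhole m l u (All<1+m∧∉⇒All<m m l l<1+m m∉))
... | yes m∈ with ∈-∃++ m∈
...   | pre , post , refl with Unique-delete m pre post u
...     | u′ , m∉ = subst (_≤ suc m) (sym (length-insert m pre post))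
          (s≤s (pigeonhole m (pre ++ post) u′ (All<1+m∧∉⇒All<m m _ (All-delete m pre post l<1+m) m∉)))

permsℕ-complete : ∀ n l → IsPermℕ n l → l ∈ permsℕ n
permsℕ-complete zero    [] _ = here refl
permsℕ-complete (suc m) l (len , l<1+m , u) with m ∈? l
... | no  m∉ = ⊥-elim (1+n≰n (subst (_≤ m) len (pigeonhole m l u (All<1+m∧∉⇒All<m m l l<1+m m∉))))
... | yes m∈ with ∈-∃++ m∈
...   | pre , post , refl with Unique-delete m pre post u
...     | u′ , m∉ = ∈-concatMap⁺ (insertions m) {xs = permsℕ m} (lose
          (permsℕ-complete m (pre ++ post) (len′ , All<1+m∧∉⇒All<m m _ (All-delete m pre post l<1+m) m∉ , u′))
          (∈-insertions⁺ m pre post))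
  where
  len′ : length (pre ++ post) ≡ m
  len′ = suc-injective (trans (sym (length-insert m pre post)) len)

∈-words⁻ : ∀ n k l → l ∈ words n k → length l ≡ k
∈-words⁻ n zero    l (here refl) = refl
∈-words⁻ n (suc k) l l∈ with find (∈-concatMap⁻ (λ x → map (x ∷_) (words n k)) {xs = allFin n} l∈)
... | x , _ , l∈x with ∈-map⁻ (x ∷_) l∈x
...   | l′ , l′∈ , refl = cong suc (∈-words⁻ n k l′ l′∈)

∈-words⁺ : ∀ n k l → length l ≡ k → l ∈ words n k
∈-words⁺ n zero    []      refl = here refl
∈-words⁺ n (suc k) (x ∷ l) refl = ∈-concatMap⁺ (λ x → map (x ∷_) (words n k)) {xs = allFin n}
  (lose (∈-allFin x) (∈-map⁺ (x ∷_) (∈-words⁺ n k l refl)))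

words-unique : ∀ n k → Unique (words n k)
words-unique n zero    = [] ∷ []
words-unique n (suc k) = Unique-concatMap (λ x → map (x ∷_) (words n k)) (allFin n) (Unique.allFin⁺ n)
  (λ x _ → Unique.map⁺ (λ eq → proj₂ (List.∷-injective eq)) (words-unique n k))
  (λ x y c _ _ c∈x c∈y → same-head x y c c∈x c∈y)
  where
  same-head : ∀ x y c → c ∈ map (x ∷_) (words n k) → c ∈ map (y ∷_) (words n k) → x ≡ y
  same-head x y c c∈x c∈y with ∈-map⁻ (x ∷_) c∈x | ∈-map⁻ (y ∷_) c∈y
  ... | _ , _ , refl | _ , _ , eq = proj₁ (List.∷-injective eq)

permsToℕ : ℕ → List (List ℕ)
permsToℕ n = map (map toℕ) (perms n)

permsToℕ-unique : ∀ n → Unique (permsToℕ n)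
permsToℕ-unique n = Unique.map⁺ (List.map-injective Fin.toℕ-injective)
  (Unique.filter⁺ (UniqueDec.unique? Fin._≟_) (words-unique n n))

permsToℕ-sound : ∀ n l → l ∈ permsToℕ n → IsPermℕ n l
permsToℕ-sound n l l∈ with ∈-map⁻ (map toℕ) l∈
... | π , π∈ , refl with ∈-filter⁻ (UniqueDec.unique? Fin._≟_) {xs = words n n} π∈
...   | π∈words , u = trans (List.length-map toℕ π) (∈-words⁻ n n π π∈words) ,
                      All.map⁺ (All.tabulate (λ {x} _ → Fin.toℕ<n x)) ,
                      Unique.map⁺ Fin.toℕ-injective u

toFins : ∀ n (l : List ℕ) → All (_< n) l → List (Fin n)
toFins n []      []           = []
toFins n (x ∷ l) (x<n ∷ l<n) = fromℕ< x<n ∷ toFins n l l<n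

map-toℕ-toFins : ∀ n l (l<n : All (_< n) l) → map toℕ (toFins n l l<n) ≡ l
map-toℕ-toFins n []      []           = refl
map-toℕ-toFins n (x ∷ l) (x<n ∷ l<n) = cong₂ _∷_ (Fin.toℕ-fromℕ< x<n) (map-toℕ-toFins n l l<n)

permsToℕ-complete : ∀ n l → IsPermℕ n l → l ∈ permsToℕ n
permsToℕ-complete n l (len , l<n , u) = subst (_∈ permsToℕ n) (map-toℕ-toFins n l l<n)
  (∈-map⁺ (map toℕ) (∈-filter⁺ (UniqueDec.unique? Fin._≟_) {xs = words n n} (∈-words⁺ n n π π-length) π-unique))
  where
  π : List (Fin n)
  π = toFins n l l<n
  π-length : length π ≡ n
  π-length = trans (sym (List.length-map toℕ π)) (trans (cong length (map-toℕ-toFins n l l<n)) len)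
  π-unique : Unique π
  π-unique = Unique.map⁻ (subst Unique (sym (map-toℕ-toFins n l l<n)) u)

permsToℕ↭permsℕ : ∀ n → permsToℕ n ↭ permsℕ n
permsToℕ↭permsℕ n = ∼bag⇒↭ (unique∧set⇒bag (permsToℕ-unique n) (permsℕ-unique n)
  λ {l} → mk⇔ (λ l∈ → permsℕ-complete n l (permsToℕ-sound n l l∈))
              (λ l∈ → permsToℕ-complete n l (permsℕ-sound n l l∈)))

-- P_(m+1) = d_(m+1) + x d_m

coeff-X^ : ∀ j i → coeff (X ^ₚ j) i ≡ + indicator (j ≡ᵇ i)
coeff-X^ zero    zero    = refl
coeff-X^ zero    (suc i) = refl
coeff-X^ (suc j) zero    = X⊛ (X ^ₚ j) zero
coeff-X^ (suc j) (suc i) = trans (X⊛ (X ^ₚ j) (suc i)) (coeff-X^ j i)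

coeff-foldr-X^ : ∀ (g : A → ℕ) xs i →
  coeff (foldr (λ x acc → (X ^ₚ g x) ⊕ acc) [] xs) i ≡ + sumOver (λ x → indicator (g x ≡ᵇ i)) xs
coeff-foldr-X^ g []       i = refl
coeff-foldr-X^ g (x ∷ xs) i = begin
    coeff ((X ^ₚ g x) ⊕ foldr (λ x acc → (X ^ₚ g x) ⊕ acc) [] xs) i
  ≡⟨ coeff-⊕ (X ^ₚ g x) _ i ⟩
    coeff (X ^ₚ g x) i ℤ.+ coeff (foldr (λ x acc → (X ^ₚ g x) ⊕ acc) [] xs) i
  ≡⟨ cong₂ ℤ._+_ (coeff-X^ (g x) i) (coeff-foldr-X^ g xs i) ⟩
    + indicator (g x ≡ᵇ i) ℤ.+ + sumOver (λ x → indicator (g x ≡ᵇ i)) xs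
  ≡⟨ ℤ.pos-+ (indicator (g x ≡ᵇ i)) _ ⟨
    + sumOver (λ x → indicator (g x ≡ᵇ i)) (x ∷ xs)
  ∎
  where open ≡-Reasoning

sumOver-filter : ∀ {P : A → Set} (P? : Decidable P) (p : A → Bool) xs →
  sumOver (λ x → indicator (p x)) (filter P? xs) ≡ sumOver (λ x → indicator (does (P? x) ∧ p x)) xs
sumOver-filter P? p []       = refl
sumOver-filter P? p (x ∷ xs) with does (P? x)
... | true  = cong (λ n → indicator (p x) + n) (sumOver-filter P? p xs)
... | false = sumOver-filter P? p xs

asc≡ascents : ∀ {n} (π : List (Fin n)) → asc π ≡ ascents (map toℕ π)
asc≡ascents []          = refl
asc≡ascents (x ∷ [])    = refl
asc≡ascents (x ∷ y ∷ π) with asc≡ascents (y ∷ π) | toℕ x <ᵇ toℕ y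
... | ih | true  = cong suc ih
... | ih | false = ih

noSuccession?≡successions≡ᵇ0 : ∀ {n} (π : List (Fin n)) →
  does (noSuccession? π) ≡ (successions (map toℕ π) ≡ᵇ 0)
noSuccession?≡successions≡ᵇ0 []          = refl
noSuccession?≡successions≡ᵇ0 (x ∷ [])    = refl
noSuccession?≡successions≡ᵇ0 (x ∷ y ∷ π)
  with noSuccession?≡successions≡ᵇ0 (y ∷ π) | toℕ y ≡ᵇ suc (toℕ x)
... | ih | true  = refl
... | ih | false = ih

pTerm : ℕ → List ℕ → ℕ
pTerm i l = indicator ((successions l ≡ᵇ 0) ∧ (ascents l + 1 ≡ᵇ i))

coeff-P : ∀ n i → coeff (P n) i ≡ + sumOver (pTerm i) (permsℕ n)
coeff-P n i = begin
    coeff (P n) i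
  ≡⟨ coeff-foldr-X^ (λ π → asc π + 1) (Q n) i ⟩
    + sumOver (λ π → indicator (asc π + 1 ≡ᵇ i)) (filter noSuccession? (perms n))
  ≡⟨ cong +_ (sumOver-filter noSuccession? (λ π → asc π + 1 ≡ᵇ i) (perms n)) ⟩
    + sumOver (λ π → indicator (does (noSuccession? π) ∧ (asc π + 1 ≡ᵇ i))) (perms n)
  ≡⟨ cong +_ (sumOver-cong (perms n) λ π _ → cong₂ (λ u v → indicator (u ∧ (v + 1 ≡ᵇ i)))
       (noSuccession?≡successions≡ᵇ0 π) (asc≡ascents π)) ⟩
    + sumOver (λ π → pTerm i (map toℕ π)) (perms n)
  ≡⟨ cong +_ (sumOver-map (pTerm i) (map toℕ) (perms n)) ⟨
    + sumOver (pTerm i) (permsToℕ n)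
  ≡⟨ cong +_ (sumOver-↭ (pTerm i) (permsToℕ↭permsℕ n)) ⟩
    + sumOver (pTerm i) (permsℕ n)
  ∎
  where open ≡-Reasoning

sumOver-pTerm-0 : ∀ m → sumOver (pTerm 0) (permsℕ (suc m)) ≡ 0
sumOver-pTerm-0 m = sumOver-zero (permsℕ (suc m)) _ λ l _ →
  cong indicator (trans (cong (λ n → (successions l ≡ᵇ 0) ∧ (n ≡ᵇ 0)) (+-comm (ascents l) 1))
                        (∧-zeroʳ (successions l ≡ᵇ 0)))

sumOver-pTerm-suc : ∀ m a → sumOver (pTerm (suc a)) (permsℕ (suc m)) ≡ d m a + d (suc m) (suc a)
sumOver-pTerm-suc m a = begin
    sumOver (pTerm (suc a)) (permsℕ (suc m))
  ≡⟨ sumOver-cong (permsℕ (suc m)) (λ l _ → pointwise (ascents l) (successions l) (endsWith m l)) ⟩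
    total m (λ a′ s f → exactly a 0 true a′ s f + exactly a 0 false a′ s f)
  ≡⟨ total-+ m (exactly a 0 true) (exactly a 0 false) ⟩
    noSuccCount m a true + noSuccCount m a false
  ≡⟨ cong (_+ noSuccCount m a false) (noSuccCount-true≡d m a) ⟩
    d m a + d (suc m) (suc a)
  ∎
  where
  open ≡-Reasoning
  pointwise : ∀ a′ s f →
    indicator ((s ≡ᵇ 0) ∧ (a′ + 1 ≡ᵇ suc a)) ≡ exactly a 0 true a′ s f + exactly a 0 false a′ s f
  pointwise a′ s f rewrite +-comm a′ 1 | ∧-comm (s ≡ᵇ 0) (a′ ≡ᵇ a) = sym (exactly-true+false a 0 a′ s f)

P≈γ⊕Xγ : ∀ m → P (suc m) ≈ₚ (gammaExpansion (suc m) (γ (suc m)) ⊕ (X ⊛ gammaExpansion m (γ m)))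
P≈γ⊕Xγ m i = begin
    coeff (P (suc m)) i
  ≡⟨ coeff-P (suc m) i ⟩
    + sumOver (pTerm i) (permsℕ (suc m))
  ≡⟨ by-degree i ⟩
    coeff (gammaExpansion (suc m) (γ (suc m))) i ℤ.+ coeff (+ 0 ∷ gammaExpansion m (γ m)) i
  ≡⟨ cong (λ z → coeff (gammaExpansion (suc m) (γ (suc m))) i ℤ.+ z) (X⊛ (gammaExpansion m (γ m)) i) ⟨
    coeff (gammaExpansion (suc m) (γ (suc m))) i ℤ.+ coeff (X ⊛ gammaExpansion m (γ m)) i
  ≡⟨ coeff-⊕ (gammaExpansion (suc m) (γ (suc m))) _ i ⟨
    coeff (gammaExpansion (suc m) (γ (suc m)) ⊕ (X ⊛ gammaExpansion m (γ m))) i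
  ∎
  where
  open ≡-Reasoning
  by-degree : ∀ i → + sumOver (pTerm i) (permsℕ (suc m))
    ≡ coeff (gammaExpansion (suc m) (γ (suc m))) i ℤ.+ coeff (+ 0 ∷ gammaExpansion m (γ m)) i
  by-degree zero
    rewrite sumOver-pTerm-0 m | coeff-gammaExpansion-γ (suc m) 0 | sym (d≡γcoeff (suc m) 0) = refl
  by-degree (suc a)
    rewrite sumOver-pTerm-suc m a | coeff-gammaExpansion-γ (suc m) (suc a) | coeff-gammaExpansion-γ m a
          | sym (d≡γcoeff (suc m) (suc a)) | sym (d≡γcoeff m a) =
    trans (cong +_ (+-comm (d m a) _)) (ℤ.pos-+ (d (suc m) (suc a)) (d m a))

proposition2p1 : (n : ℕ) → 0 < n →
    Σ Poly λ a → Σ Poly λ b →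
    Σ (ℕ → ℕ) λ α → Σ (ℕ → ℕ) λ β →
      (P n ≈ₚ (a ⊕ (X ⊛ b)))
      × SymmetricOf n a
      × SymmetricOf (n ∸ 1) b
      × (a ≈ₚ gammaExpansion n α)
      × (b ≈ₚ gammaExpansion (n ∸ 1) β)
proposition2p1 (suc m) _ =
  gammaExpansion (suc m) (γ (suc m)) , gammaExpansion m (γ m) , γ (suc m) , γ m ,
  P≈γ⊕Xγ m ,
  gammaExpansion-symmetric (suc m) (γ (suc m)) , gammaExpansion-symmetric m (γ m) ,
  (λ _ → refl) , (λ _ → refl)
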